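{- Let $\mathcal G$ be the set of pasting schemes $G$ whose sets of cells $G_n$ ($n\in\mathbb N$) are pairwise disjoint subsets of the set of variables. Then the assignment $\Gamma\mapsto G^\Gamma$ is a bijection from the set of ps-contexts onto $\mathcal G$.
   Context: Globular sets: sets $(G_n)_{n\in\mathbb N}$ with $s_n,t_n:G_{n+1}\to G_n$, $s_n s_{n+1}=s_n t_{n+1}$, $t_n s_{n+1}=t_n t_{n+1}$. $D_n$ is the $n$-disk (cells $x_k^\pm$ for $k<n$ and $x_n$, with $s(x_{k+1}^\pm)=x_k^-$, $t(x_{k+1}^\pm)=x_k^+$, $s(x_n)=x_{n-1}^-$, $t(x_n)=x_{n-1}^+$); for $j\le i$, $\sigma^i_j,\tau^i_j:D_j\to D_i$ fix $x_k^\pm$ ($k<j$) and send $x_j$ to $x_j^-$, resp. $x_j^+$ (identities if $j=i$). A pasting scheme is a globular set isomorphic to a colimit of a diagram $D_{i_0}\xleftarrow{\tau^{i_0}_{j_1}}D_{j_1}\xrightarrow{\sigma^{i_1}_{j_1}}D_{i_1}\leftarrow\cdots\leftarrow D_{j_k}\xrightarrow{\sigma^{i_k}_{j_k}}D_{i_k}$ with $k\ge0$, $j_m\le\min(i_{m-1},i_m)$. Types over a fixed countably infinite set of variables: $\star$, and $\mathrm{Hom}_A(t,u)$ for a type $A$ and variables $t,u$; $\dim\star=0$, $\dim\mathrm{Hom}_A(t,u)=\dim A+1$. Contexts are lists $x_1:A_1,\dots,x_n:A_n$; $FV(\Gamma)$ is the set of variables occurring in $\Gamma$. Judgments $\Gamma\vdash_{ps}$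 and $\Gamma\vdash_{ps}x:A$ are generated by: $x:\star\vdash_{ps}x:\star$; from $\Gamma\vdash_{ps}x:A$ infer $\Gamma,y:A,f:\mathrm{Hom}_A(x,y)\vdash_{ps}f:\mathrm{Hom}_A(x,y)$ provided $y,f\notin FV(\Gamma)$; from $\Gamma\vdash_{ps}f:\mathrm{Hom}_A(x,y)$ infer $\Gamma\vdash_{ps}y:A$; from $\Gamma\vdash_{ps}x:\star$ infer $\Gamma\vdash_{ps}$. A ps-context is a context $\Gamma$ with $\Gamma\vdash_{ps}$ (its variables are pairwise distinct). For a ps-context $\Gamma=(x_i:A_i)_{1\le i\le k}$, $G^\Gamma$ is the globular set with $G^\Gamma_n=\{x_i:\dim A_i=n\}$ and, for $A_i=\mathrm{Hom}_B(y,z)$, source $y$ and target $z$ of $x_i$. -}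

module Defs where

open import Data.Nat using (ℕ; zero; suc; _≤_; z≤n; s≤s; _≡ᵇ_)
open import Data.Bool using (Bool; true; false; T)
open import Data.Bool.Properties using (T-irrelevant)
open import Data.Unit using (⊤; tt)
open import Data.Empty using (⊥)
open import Data.Fin using (Fin; inject₁) renaming (suc to fsuc)
open import Data.Maybe using (Maybe; just; nothing)
open import Data.Product using (Σ; _×_; _,_; proj₁; proj₂)
open import Data.Sum using (_⊎_)
open import Relation.Nullary using (¬_)
open import Relation.Binary.PropositionalEquality using (_≡_; _≢_; refl; cong)

record GSet : Set₁ where
  field
    Cell : ℕ → Set
    s t  : ∀ n → Cell (suc n) → Cell n
    ss   : ∀ n x → s n (s (suc n) x) ≡ s n (t (suc n) x)
    ts   : ∀ n x → t n (s (suc n) x) ≡ t n (t (suc n) x)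
open GSet public

record GMor (G H : GSet) : Set where
  field
    fun : ∀ n → Cell G n → Cell H n
    fs  : ∀ n x → fun n (s G n x) ≡ s H n (fun (suc n) x)
    ft  : ∀ n x → fun n (t G n x) ≡ t H n (fun (suc n) x)
open GMor public

-- Disks D_n.  At level k < n the cells are x_k^- (false) and x_k^+ (true);
-- at level n the single cell x_n (tt); above n no cells.

DCell : ℕ → ℕ → Set
DCell zero    zero    = ⊤
DCell zero    (suc k) = ⊥
DCell (suc n) zero    = Bool
DCell (suc n) (suc k) = DCell n k

ds dt : ∀ n k → DCell n (suc k) → DCell n k
ds zero    k       ()
ds (suc n) zero    _ = false
ds (suc n) (suc k) x = ds n k x
dt zero    k       ()
dt (suc n) zero    _ = true
dt (suc n) (suc k) x = dt n k x

dss : ∀ n k x → ds n k (ds n (suc k) x) ≡ ds n k (dt n (suc k) x)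
dss zero    k       ()
dss (suc n) zero    x = refl
dss (suc n) (suc k) x = dss n k x

dts : ∀ n k x → dt n k (ds n (suc k) x) ≡ dt n k (dt n (suc k) x)
dts zero    k       ()
dts (suc n) zero    x = refl
dts (suc n) (suc k) x = dts n k x

D : ℕ → GSet
D n = record { Cell = DCell n ; s = ds n ; t = dt n ; ss = dss n ; ts = dts n }

-- incl b p : D_j → D_i (for p : j ≤ i) fixes x_k^± (k < j) and sends x_j
-- to x_j^b (to x_j itself if j = i).  σ^i_j = incl false, τ^i_j = incl true.
incl : Bool → ∀ {j i} → j ≤ i → ∀ k → DCell j k → DCell i k
incl b {i = zero}  z≤n zero    tt = tt
incl b {i = suc i} z≤n zero    tt = b
incl b             z≤n (suc k) ()
incl b (s≤s p) zero    x = x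
incl b (s≤s p) (suc k) x = incl b p k x

σ τ : ∀ {j i} → j ≤ i → ∀ k → DCell j k → DCell i k
σ = incl false
τ = incl true

-- Diagrams D_{i_0} <-τ- D_{j_1} -σ-> D_{i_1} <- ... -> D_{i_k}
-- (positions m : Fin (suc k) for the i's, m : Fin k for the j's, j_{m+1}
-- sits between i_m and i_{m+1}).

record Diagram : Set where
  field
    len : ℕ
    i   : Fin (suc len) → ℕ
    j   : Fin len → ℕ
    jl  : ∀ m → j m ≤ i (inject₁ m)
    jr  : ∀ m → j m ≤ i (fsuc m)
open Diagram public

Cocone : Diagram → GSet → Set
Cocone d G =
  Σ ((m : Fin (suc (len d))) → GMor (D (i d m)) G) λ c →
    ∀ m k (x : DCell (j d m) k) →
      fun (c (inject₁ m)) k (τ (jl d m) k x) ≡ fun (c (fsuc m)) k (σ (jr d m) k x)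

IsColimit : (d : Diagram) (G : GSet) → Cocone d G → Set₁
IsColimit d G (c , _) =
  (H : GSet) (e : Cocone d H) →
    Σ (GMor G H) λ u →
      (∀ m n x → fun u n (fun (c m) n x) ≡ fun (proj₁ e m) n x)
      × ((u' : GMor G H) →
           (∀ m n x → fun u' n (fun (c m) n x) ≡ fun (proj₁ e m) n x) →
           ∀ n x → fun u n x ≡ fun u' n x)

IsPastingScheme : GSet → Set₁
IsPastingScheme G = Σ Diagram λ d → Σ (Cocone d G) (IsColimit d G)

Var : Set
Var = ℕ

data Ty : Set where
  ⋆   : Ty
  Hom : Ty → Var → Var → Ty

dim : Ty → ℕ
dim ⋆           = 0
dim (Hom A _ _) = suc (dim A)

data Ctx : Set where
  ∅     : Ctx
  _▸_∶_ : Ctx → Var → Ty → Ctx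

infixl 5 _▸_∶_

_∈Ty_ : Var → Ty → Set
x ∈Ty ⋆         = ⊥
x ∈Ty Hom A y z = x ∈Ty A ⊎ (x ≡ y ⊎ x ≡ z)

_∈FV_ : Var → Ctx → Set
x ∈FV ∅           = ⊥
x ∈FV (Γ ▸ y ∶ A) = x ∈FV Γ ⊎ (x ≡ y ⊎ x ∈Ty A)

_∉FV_ : Var → Ctx → Set
x ∉FV Γ = ¬ (x ∈FV Γ)

data _⊢ps_∶_ : Ctx → Var → Ty → Set where
  ps-start : ∀ x → (∅ ▸ x ∶ ⋆) ⊢ps x ∶ ⋆
  ps-ext   : ∀ {Γ x A y f} → Γ ⊢ps x ∶ A → y ∉FV Γ → f ∉FV Γ → y ≢ f →
             (Γ ▸ y ∶ A ▸ f ∶ Hom A x y) ⊢ps f ∶ Hom A x y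
  ps-drop  : ∀ {Γ f A x y} → Γ ⊢ps f ∶ Hom A x y → Γ ⊢ps y ∶ A

data _⊢ps : Ctx → Set where
  ps-done : ∀ {Γ x} → Γ ⊢ps x ∶ ⋆ → Γ ⊢ps

-- Globular sets whose cell sets are subsets of Var:
-- mem n v says v ∈ G_n; src n, tgt n : G_{n+1} → G_n (values outside
-- G_{n+1} are irrelevant).

record VGSet : Set where
  field
    mem      : ℕ → Var → Bool
    src tgt  : ℕ → Var → Var
open VGSet public

record IsGlobular (G : VGSet) : Set where
  field
    src-in : ∀ n v → T (mem G (suc n) v) → T (mem G n (src G n v))
    tgt-in : ∀ n v → T (mem G (suc n) v) → T (mem G n (tgt G n v))
    glob-s : ∀ n v → T (mem G (suc (suc n)) v) →
             src G n (src G (suc n) v) ≡ src G n (tgt G (suc n) v)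
    glob-t : ∀ n v → T (mem G (suc (suc n)) v) →
             tgt G n (src G (suc n) v) ≡ tgt G n (tgt G (suc n) v)
open IsGlobular public

Disjoint : VGSet → Set
Disjoint G = ∀ n m v → T (mem G n v) → T (mem G m v) → n ≡ m

private
  Σ≡ : ∀ {P : Var → Bool} {v w : Var} {p : T (P v)} {q : T (P w)} →
       v ≡ w → _≡_ {A = Σ Var (λ u → T (P u))} (v , p) (w , q)
  Σ≡ {P} {v} {p = p} {q} refl = cong (v ,_) (T-irrelevant p q)

toGSet : (G : VGSet) → IsGlobular G → GSet
toGSet G w = record
  { Cell = λ n → Σ Var (λ v → T (mem G n v))
  ; s    = λ n x → src G n (proj₁ x) , src-in w n (proj₁ x) (proj₂ x)
  ; t    = λ n x → tgt G n (proj₁ x) , tgt-in w n (proj₁ x) (proj₂ x)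
  ; ss   = λ n x → Σ≡ (glob-s w n (proj₁ x) (proj₂ x))
  ; ts   = λ n x → Σ≡ (glob-t w n (proj₁ x) (proj₂ x))
  }

In𝒢 : VGSet → Set₁
In𝒢 G = Σ (IsGlobular G) (λ w → IsPastingScheme (toGSet G w)) × Disjoint G

SameVG : VGSet → VGSet → Set
SameVG G H =
  (∀ n v → mem G n v ≡ mem H n v)
  × (∀ n v → T (mem G (suc n) v) → src G n v ≡ src H n v × tgt G n v ≡ tgt H n v)

lookupVar : Ctx → Var → Maybe Ty
lookupVar ∅ v = nothing
lookupVar (Γ ▸ x ∶ A) v with v Data.Nat.≟ x
... | Relation.Nullary.yes _ = just A
... | Relation.Nullary.no  _ = lookupVar Γ v

G^ : Ctx → VGSet
G^ Γ = record
  { mem = λ n v → memT (lookupVar Γ v) n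
  ; src = λ n v → srcT (lookupVar Γ v) v
  ; tgt = λ n v → tgtT (lookupVar Γ v) v
  }
  where
  memT : Maybe Ty → ℕ → Bool
  memT (just A) n = dim A ≡ᵇ n
  memT nothing  n = false
  srcT tgtT : Maybe Ty → Var → Var
  srcT (just (Hom A y z)) _ = y
  srcT _                  v = v
  tgtT (just (Hom A y z)) _ = z
  tgtT _                  v = v

-- A derivation of Γ ⊢ps is read as a construction of G^Γ from disks: the start rule gives D_0, and
-- extending by y : A, f : Hom_A(x, y) glues a new disk D_{n+1} along its source to the n-cell x, a
-- pushout. Hence G^Γ is the colimit of a diagram of disks (cocones being described by cells, by the
-- Yoneda lemma). Conversely, every such diagram is realised by a ps-context on fresh variables, which
-- is renamed into a given G along the isomorphism of colimits; the renaming is injective because the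
-- cell sets of G are disjoint. Finally Γ is recovered from G^Γ: its last variable f is the unique cell
-- that is neither a source nor a target and whose iterated targets are not sources, its target is the
-- variable declared just before it, and removing both leaves a ps-context again.
module Submission where

open import Defs
open import Data.Nat using (ℕ; zero; suc; _<_; _≤_; _≤′_; ≤′-reflexive; ≤′-refl; ≤′-step; z≤n; s≤s; _≟_; _≡ᵇ_)
open import Data.Nat.Properties
  using (1+n≰n; <-irrefl; <-trans; m≤n⇒m<n∨m≡n; m≤n⇒m≤1+n; n<1+n; n≤1+n; ≡-irrelevant;
         ≡ᵇ⇒≡; ≡⇒≡ᵇ; ≤-irrelevant; ≤-refl; ≤-total; ≤-trans; ≤′-trans; ≤′⇒≤; ≤⇒≤′)
open import Data.Bool using (Bool; T; false; true)
open import Data.Bool.Properties using (T-irrelevant)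
open import Data.Unit using (tt)
open import Data.Empty using (⊥; ⊥-elim)
open import Data.Product using (_,_; _×_; proj₁; proj₂; Σ)
open import Data.Sum using (_⊎_; inj₁; inj₂)
open import Data.Fin using (Fin; fromℕ; inject₁) renaming (zero to fzero; suc to fsuc)
open import Data.Maybe using (Maybe; just; nothing)
open import Data.Maybe.Properties using (just-injective)
open import Function using (_∘_)
open import Relation.Nullary using (no; yes; ¬_)
open import Relation.Binary.PropositionalEquality
  using (_≡_; _≢_; cong; cong₂; refl; subst; subst₂; sym; trans; module ≡-Reasoning)
open import Relation.Binary.PropositionalEquality.Properties using (subst-subst)
open ≡-Reasoning

idᴹ : ∀ {G} → GMor G G
idᴹ = record { fun = λ n x → x ; fs = λ n x → refl ; ft = λ n x → refl }

_∘ᴹ_ : ∀ {G H K} → GMor H K → GMor G H → GMor G K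
v ∘ᴹ u = record
  { fun = λ n x → fun v n (fun u n x)
  ; fs  = λ n x → trans (cong (fun v n) (fs u n x)) (fs v n (fun u (suc n) x))
  ; ft  = λ n x → trans (cong (fun v n) (ft u n x)) (ft v n (fun u (suc n) x))
  }

-- Iterated sources and targets

≤′-irrelevant : ∀ {k n} (p q : k ≤′ n) → p ≡ q
≤′-irrelevant (≤′-reflexive e) (≤′-reflexive e′) = cong ≤′-reflexive (≡-irrelevant e e′)
≤′-irrelevant ≤′-refl (≤′-step q) = ⊥-elim (1+n≰n (≤′⇒≤ q))
≤′-irrelevant (≤′-step p) ≤′-refl = ⊥-elim (1+n≰n (≤′⇒≤ p))
≤′-irrelevant (≤′-step p) (≤′-step q) = cong ≤′-step (≤′-irrelevant p q)

<′⇒≤′ : ∀ {k n} → suc k ≤′ n → k ≤′ n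
<′⇒≤′ = ≤′-trans (≤′-step ≤′-refl)

∂ : (X : GSet) → Bool → ∀ k → Cell X (suc k) → Cell X k
∂ X false = s X
∂ X true  = t X

module _ (X : GSet) where

  iterTgt : ∀ {k n} → k ≤′ n → Cell X n → Cell X k
  iterTgt ≤′-refl      a = a
  iterTgt (≤′-step p) a = iterTgt p (t X _ a)

  iterSrc : ∀ {k n} → k ≤′ n → Cell X n → Cell X k
  iterSrc ≤′-refl      a = a
  iterSrc (≤′-step p) a = iterSrc p (s X _ a)

  iter∂ : Bool → ∀ {k n} → k ≤′ n → Cell X n → Cell X k
  iter∂ false = iterSrc
  iter∂ true  = iterTgt

  iter∂-refl : ∀ b {n} (p : n ≤′ n) a → iter∂ b p a ≡ a
  iter∂-refl b p a with ≤′-irrelevant p ≤′-refl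
  iter∂-refl false .≤′-refl a | refl = refl
  iter∂-refl true  .≤′-refl a | refl = refl

  iterTgt-last : ∀ {k n} (q : suc k ≤′ n) a → iterTgt (<′⇒≤′ q) a ≡ t X k (iterTgt q a)
  iterTgt-last ≤′-refl     a = refl
  iterTgt-last (≤′-step q) a = iterTgt-last q (t X _ a)

  s-iterTgt-globular : ∀ {k n} (q : suc k ≤′ n) (a : Cell X (suc n)) →
                       s X k (iterTgt q (s X n a)) ≡ s X k (iterTgt q (t X n a))
  s-iterTgt-globular ≤′-refl     a = ss X _ a
  s-iterTgt-globular (≤′-step q) a = cong (λ w → s X _ (iterTgt q w)) (ts X _ a)

  -- By globularity, the last source step may be taken after iterated targets.
  iterSrc-last : ∀ {k n} (q : suc k ≤′ n) a → iterSrc (<′⇒≤′ q) a ≡ s X k (iterTgt q a)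
  iterSrc-last ≤′-refl     a = refl
  iterSrc-last (≤′-step q) a = trans (iterSrc-last q (s X _ a)) (s-iterTgt-globular q a)

  iter∂-last : ∀ b {k n} (q : suc k ≤′ n) a → iter∂ b (<′⇒≤′ q) a ≡ ∂ X b k (iterTgt q a)
  iter∂-last false = iterSrc-last
  iter∂-last true  = iterTgt-last

  ∂-∘-t : ∀ b′ b {k} (w : Cell X (suc (suc k))) → ∂ X b′ k (t X (suc k) w) ≡ ∂ X b′ k (∂ X b (suc k) w)
  ∂-∘-t false false w = sym (ss X _ w)
  ∂-∘-t false true  w = refl
  ∂-∘-t true  false w = sym (ts X _ w)
  ∂-∘-t true  true  w = refl

module _ {X Y : GSet} (u : GMor X Y) where

  ∂-natural : ∀ b k a → fun u k (∂ X b k a) ≡ ∂ Y b k (fun u (suc k) a)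
  ∂-natural false = fs u
  ∂-natural true  = ft u

  iterTgt-natural : ∀ {k n} (p : k ≤′ n) a → fun u k (iterTgt X p a) ≡ iterTgt Y p (fun u n a)
  iterTgt-natural ≤′-refl     a = refl
  iterTgt-natural (≤′-step p) a = trans (iterTgt-natural p (t X _ a)) (cong (iterTgt Y p) (ft u _ a))

  iterSrc-natural : ∀ {k n} (p : k ≤′ n) a → fun u k (iterSrc X p a) ≡ iterSrc Y p (fun u n a)
  iterSrc-natural ≤′-refl     a = refl
  iterSrc-natural (≤′-step p) a = trans (iterSrc-natural p (s X _ a)) (cong (iterSrc Y p) (fs u _ a))

  iter∂-natural : ∀ b {k n} (p : k ≤′ n) a → fun u k (iter∂ X b p a) ≡ iter∂ Y b p (fun u n a)
  iter∂-natural false = iterSrc-natural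
  iter∂-natural true  = iterTgt-natural

-- Disks and the Yoneda lemma

xₙ : ∀ n → DCell n n
xₙ zero    = tt
xₙ (suc n) = xₙ n

x± : ∀ {k n} → Bool → k < n → DCell n k
x± {zero}  {suc n} b _       = b
x± {suc k} {suc n} b (s≤s p) = x± {k} {n} b p

x±-irrelevant : ∀ {k n} b (p q : k < n) → x± {k} {n} b p ≡ x± b q
x±-irrelevant b p q = cong (x± b) (≤-irrelevant p q)

data DiskView : ∀ n k → DCell n k → Set where
  top  : ∀ n → DiskView n n (xₙ n)
  side : ∀ n k b (p : k < n) → DiskView n k (x± b p)

diskView : ∀ n k (z : DCell n k) → DiskView n k z
diskView zero    zero    tt = top zero
diskView zero    (suc k) ()
diskView (suc n) zero    b  = side (suc n) zero b (s≤s z≤n)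
diskView (suc n) (suc k) z with diskView n k z
... | top .n          = top (suc n)
... | side .n .k b p  = side (suc n) (suc k) b (s≤s p)

diskView-top : ∀ n → diskView n n (xₙ n) ≡ top n
diskView-top zero                            = refl
diskView-top (suc n) rewrite diskView-top n  = refl

diskView-side : ∀ n k b (p : k < n) → diskView n k (x± b p) ≡ side n k b p
diskView-side (suc n) zero    b (s≤s z≤n)                             = refl
diskView-side (suc n) (suc k) b (s≤s p) rewrite diskView-side n k b p = refl

DCell-level : ∀ n k → DCell n k → k ≤ n
DCell-level zero    zero    _ = z≤n
DCell-level zero    (suc k) ()
DCell-level (suc n) zero    _ = z≤n
DCell-level (suc n) (suc k) z = s≤s (DCell-level n k z)

∂-disk : ∀ n b k (z : DCell n (suc k)) → ∂ (D n) b k z ≡ x± b (DCell-level n (suc k) z)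
∂-disk zero    b     k       ()
∂-disk (suc n) false zero    z = refl
∂-disk (suc n) true  zero    z = refl
∂-disk (suc n) false (suc k) z = ∂-disk n false k z
∂-disk (suc n) true  (suc k) z = ∂-disk n true k z

module _ (X : GSet) where

  yonedaView : ∀ {n k z} → Cell X n → DiskView n k z → Cell X k
  yonedaView a (top n)        = a
  yonedaView a (side n k b p) = ∂ X b k (iterTgt X (≤⇒≤′ p) a)

  yonedaFun : ∀ n → Cell X n → ∀ k → DCell n k → Cell X k
  yonedaFun n a k z = yonedaView a (diskView n k z)

  yoneda-top : ∀ n a → yonedaFun n a n (xₙ n) ≡ a
  yoneda-top n a rewrite diskView-top n = refl

  yoneda-x± : ∀ n a k b (p : k < n) → yonedaFun n a k (x± b p) ≡ ∂ X b k (iterTgt X (≤⇒≤′ p) a)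
  yoneda-x± n a k b p rewrite diskView-side n k b p = refl

  yoneda-∂ : ∀ n a b k (z : DCell n (suc k)) →
             yonedaFun n a k (∂ (D n) b k z) ≡ ∂ X b k (yonedaFun n a (suc k) z)
  yoneda-∂ n a b k z with diskView n (suc k) z
  ... | top .(suc k) = begin
    yonedaFun (suc k) a k (∂ (D (suc k)) b k (xₙ (suc k)))
      ≡⟨ cong (yonedaFun (suc k) a k) (∂-disk (suc k) b k (xₙ (suc k))) ⟩
    yonedaFun (suc k) a k (x± b p)
      ≡⟨ yoneda-x± (suc k) a k b p ⟩
    ∂ X b k (iterTgt X (≤⇒≤′ p) a)
      ≡⟨ cong (λ q → ∂ X b k (iterTgt X q a)) (≤′-irrelevant (≤⇒≤′ p) ≤′-refl) ⟩
    ∂ X b k a ∎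
    where p = DCell-level (suc k) (suc k) (xₙ (suc k))
  ... | side .n .(suc k) b′ p = begin
    yonedaFun n a k (∂ (D n) b k (x± b′ p))
      ≡⟨ cong (yonedaFun n a k) (∂-disk n b k (x± b′ p)) ⟩
    yonedaFun n a k (x± b q)
      ≡⟨ yoneda-x± n a k b q ⟩
    ∂ X b k (iterTgt X (≤⇒≤′ q) a)
      ≡⟨ cong (λ r → ∂ X b k (iterTgt X r a)) (≤′-irrelevant (≤⇒≤′ q) (<′⇒≤′ (≤⇒≤′ p))) ⟩
    ∂ X b k (iterTgt X (<′⇒≤′ (≤⇒≤′ p)) a)
      ≡⟨ cong (∂ X b k) (iterTgt-last X (≤⇒≤′ p) a) ⟩
    ∂ X b k (t X (suc k) (iterTgt X (≤⇒≤′ p) a))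
      ≡⟨ ∂-∘-t X b b′ (iterTgt X (≤⇒≤′ p) a) ⟩
    ∂ X b k (∂ X b′ (suc k) (iterTgt X (≤⇒≤′ p) a)) ∎
    where q = DCell-level n (suc k) (x± b′ p)

  yoneda : ∀ n → Cell X n → GMor (D n) X
  yoneda n a = record
    { fun = yonedaFun n a
    ; fs  = yoneda-∂ n a false
    ; ft  = yoneda-∂ n a true
    }

yoneda-unique : ∀ {X n} (g : GMor (D n) X) k z → fun g k z ≡ yonedaFun X n (fun g n (xₙ n)) k z
yoneda-unique {X} {n} g k z with diskView n k z
... | top .n          = refl
... | side .n .k b p  = begin
  fun g k (x± b p)
    ≡⟨ cong (fun g k) (x±-irrelevant b p _) ⟩
  fun g k (x± b (DCell-level n (suc k) (iterTgt (D n) (≤⇒≤′ p) (xₙ n))))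
    ≡⟨ cong (fun g k) (sym (∂-disk n b k (iterTgt (D n) (≤⇒≤′ p) (xₙ n)))) ⟩
  fun g k (∂ (D n) b k (iterTgt (D n) (≤⇒≤′ p) (xₙ n)))
    ≡⟨ ∂-natural g b k _ ⟩
  ∂ X b k (fun g (suc k) (iterTgt (D n) (≤⇒≤′ p) (xₙ n)))
    ≡⟨ cong (∂ X b k) (iterTgt-natural g (≤⇒≤′ p) (xₙ n)) ⟩
  ∂ X b k (iterTgt X (≤⇒≤′ p) (fun g n (xₙ n))) ∎

yoneda-natural : ∀ {X Y n} (u : GMor X Y) a k z → fun u k (yonedaFun X n a k z) ≡ yonedaFun Y n (fun u n a) k z
yoneda-natural {X} {Y} {n} u a k z =
  trans (yoneda-unique {Y} {n} (u ∘ᴹ yoneda X n a) k z)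
        (cong (λ w → yonedaFun Y n w k z) (cong (fun u n) (yoneda-top X n a)))

incl-x± : ∀ b {j i} (p : j ≤ i) k b′ (q : k < j) → incl b p k (x± b′ q) ≡ x± b′ (≤-trans q p)
incl-x± b z≤n     k       b′ ()
incl-x± b (s≤s p) zero    b′ (s≤s q) = refl
incl-x± b (s≤s p) (suc k) b′ (s≤s q) = incl-x± b p k b′ q

incl-xₙ-< : ∀ b {j i} (p : j ≤ i) (q : j < i) → incl b p j (xₙ j) ≡ x± b q
incl-xₙ-< b {i = suc i} z≤n q       = refl
incl-xₙ-< b (s≤s p)     (s≤s q)     = incl-xₙ-< b p q

incl-xₙ-≡ : ∀ b {j} (p : j ≤ j) → incl b p j (xₙ j) ≡ xₙ j
incl-xₙ-≡ b z≤n     = refl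
incl-xₙ-≡ b (s≤s p) = incl-xₙ-≡ b p

incl-∂ : ∀ b {j i} (p : j ≤ i) b′ k (z : DCell j (suc k)) →
         incl b p k (∂ (D j) b′ k z) ≡ ∂ (D i) b′ k (incl b p (suc k) z)
incl-∂ b {j} {i} p b′ k z = begin
  incl b p k (∂ (D j) b′ k z)
    ≡⟨ cong (incl b p k) (∂-disk j b′ k z) ⟩
  incl b p k (x± b′ (DCell-level j (suc k) z))
    ≡⟨ incl-x± b p k b′ _ ⟩
  x± b′ (≤-trans (DCell-level j (suc k) z) p)
    ≡⟨ x±-irrelevant {k} {i} b′ _ _ ⟩
  x± b′ (DCell-level i (suc k) (incl b p (suc k) z))
    ≡⟨ sym (∂-disk i b′ k (incl b p (suc k) z)) ⟩
  ∂ (D i) b′ k (incl b p (suc k) z) ∎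

inclᴹ : ∀ b {j i} → j ≤ i → GMor (D j) (D i)
inclᴹ b p = record { fun = incl b p ; fs = incl-∂ b p false ; ft = incl-∂ b p true }

incl-xₙ : ∀ b {j i} (p : j ≤ i) → incl b p j (xₙ j) ≡ iter∂ (D i) b (≤⇒≤′ p) (xₙ i)
incl-xₙ b {j} {i} p with m≤n⇒m<n∨m≡n p
... | inj₂ refl = trans (incl-xₙ-≡ b p) (sym (iter∂-refl (D i) b (≤⇒≤′ p) (xₙ i)))
... | inj₁ q = begin
  incl b p j (xₙ j)                              ≡⟨ incl-xₙ-< b p q ⟩
  x± b q                                         ≡⟨ x±-irrelevant b q r ⟩
  x± b r                                         ≡⟨ sym (∂-disk i b j (iterTgt (D i) (≤⇒≤′ q) (xₙ i))) ⟩
  ∂ (D i) b j (iterTgt (D i) (≤⇒≤′ q) (xₙ i))    ≡⟨ sym (iter∂-last (D i) b (≤⇒≤′ q) (xₙ i)) ⟩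
  iter∂ (D i) b (<′⇒≤′ (≤⇒≤′ q)) (xₙ i)          ≡⟨ cong (λ r → iter∂ (D i) b r (xₙ i)) (≤′-irrelevant _ _) ⟩
  iter∂ (D i) b (≤⇒≤′ p) (xₙ i)                  ∎
  where r = DCell-level i (suc j) (iterTgt (D i) (≤⇒≤′ q) (xₙ i))

yoneda-incl : ∀ {X} b {j i} (p : j ≤ i) (a : Cell X i) k z →
              yonedaFun X i a k (incl b p k z) ≡ yonedaFun X j (iter∂ X b (≤⇒≤′ p) a) k z
yoneda-incl {X} b {j} {i} p a k z =
  trans (yoneda-unique {X} {j} (yoneda X i a ∘ᴹ inclᴹ b p) k z)
        (cong (λ w → yonedaFun X j w k z) (begin
          yonedaFun X i a j (incl b p j (xₙ j))                  ≡⟨ cong (yonedaFun X i a j) (incl-xₙ b p) ⟩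
          yonedaFun X i a j (iter∂ (D i) b (≤⇒≤′ p) (xₙ i))      ≡⟨ iter∂-natural (yoneda X i a) b (≤⇒≤′ p) (xₙ i) ⟩
          iter∂ X b (≤⇒≤′ p) (yonedaFun X i a i (xₙ i))          ≡⟨ cong (iter∂ X b (≤⇒≤′ p)) (yoneda-top X i a) ⟩
          iter∂ X b (≤⇒≤′ p) a                                    ∎))

-- Chains of disks

-- A chain of last dimension l is a diagram D_{i₀} ← D_{j₁} → ⋯ ← D_{jₖ} → D_l, built from the right.
data Chain : ℕ → Set where
  base : ∀ a → Chain a
  step : ∀ {l} → Chain l → ∀ j i → j ≤ l → j ≤ i → Chain i

-- By the Yoneda lemma a cocone under a chain is a sequence of cells whose consecutive iterated
-- target and source agree.
mutual
  Cells : ∀ {l} → Chain l → GSet → Set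
  Cells (base a)         X = Cell X a
  Cells (step L j i p q) X =
    Σ (Cells L X) λ c → Σ (Cell X i) λ h → iterTgt X (≤⇒≤′ p) (lastCell L c) ≡ iterSrc X (≤⇒≤′ q) h

  lastCell : ∀ {l} (L : Chain l) {X} → Cells L X → Cell X l
  lastCell (base a)         c           = c
  lastCell (step L j i p q) (c , h , _) = h

Factors : ∀ {l} (L : Chain l) {X H} → Cells L X → Cells L H → GMor X H → Set
Factors (base a)         c           e           u = fun u a c ≡ e
Factors (step L j i p q) (c , h , _) (e , k , _) u = Factors L c e u × fun u i h ≡ k

IsChainColimit : ∀ {l} (L : Chain l) (X : GSet) → Cells L X → Set₁
IsChainColimit L X c = (H : GSet) (e : Cells L H) →
  Σ (GMor X H) λ u → Factors L c e u × ((u′ : GMor X H) → Factors L c e u′ → ∀ n x → fun u n x ≡ fun u′ n x)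

Factors-last : ∀ {l} (L : Chain l) {X H} (c : Cells L X) (e : Cells L H) u →
               Factors L c e u → fun u l (lastCell L c) ≡ lastCell L e
Factors-last (base a)         c e u f = f
Factors-last (step L j i p q) c e u f = proj₂ f

Factors-cong : ∀ {l} (L : Chain l) {X H} (c : Cells L X) (e : Cells L H) u u′ →
               (∀ n x → fun u n x ≡ fun u′ n x) → Factors L c e u → Factors L c e u′
Factors-cong (base a)         c           e           u u′ eq f       = trans (sym (eq a c)) f
Factors-cong (step L j i p q) (c , h , _) (e , k , _) u u′ eq (f , g) =
  Factors-cong L c e u u′ eq f , trans (sym (eq i h)) g

data SnocView : ∀ {k} → Fin (suc k) → Set where
  inner : ∀ {k} (m : Fin k) → SnocView (inject₁ m)
  last  : ∀ {k} → SnocView (fromℕ k)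

snocView : ∀ {k} (m : Fin (suc k)) → SnocView m
snocView {zero}  fzero    = last
snocView {suc k} fzero    = inner fzero
snocView {suc k} (fsuc m) with snocView m
... | inner m′ = inner (fsuc m′)
... | last     = last

snocView-inject₁ : ∀ {k} (m : Fin k) → snocView (inject₁ m) ≡ inner m
snocView-inject₁ {suc k} fzero                                 = refl
snocView-inject₁ {suc k} (fsuc m) rewrite snocView-inject₁ m = refl

snocView-fromℕ : ∀ k → snocView (fromℕ k) ≡ last
snocView-fromℕ zero                              = refl
snocView-fromℕ (suc k) rewrite snocView-fromℕ k = refl

chainOf : ∀ k (i : Fin (suc k) → ℕ) (j : Fin k → ℕ) →
          (∀ m → j m ≤ i (inject₁ m)) → (∀ m → j m ≤ i (fsuc m)) → Chain (i (fromℕ k))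
chainOf zero    i j jl jr = base (i fzero)
chainOf (suc k) i j jl jr =
  step (chainOf k (λ m → i (inject₁ m)) (λ m → j (inject₁ m)) (λ m → jl (inject₁ m)) (λ m → jr (inject₁ m)))
       (j (fromℕ k)) (i (fromℕ (suc k))) (jl (fromℕ k)) (jr (fromℕ k))

toChain : (d : Diagram) → Chain (i d (fromℕ (len d)))
toChain d = chainOf (len d) (i d) (j d) (jl d) (jr d)

module _ {X : GSet} where

  cellAtView : ∀ k i j jl jr → Cells (chainOf k i j jl jr) X → (m : Fin (suc k)) → SnocView m → Cell X (i m)
  cellAtView zero    i j jl jr c           .(fromℕ zero)    last      = c
  cellAtView (suc k) i j jl jr (c , h , _) .(inject₁ m)     (inner m) =
    cellAtView k (λ m → i (inject₁ m)) (λ m → j (inject₁ m)) (λ m → jl (inject₁ m)) (λ m → jr (inject₁ m)) c m (snocView m)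
  cellAtView (suc k) i j jl jr (c , h , _) .(fromℕ (suc k)) last      = h

  cellAt : ∀ k i j jl jr → Cells (chainOf k i j jl jr) X → (m : Fin (suc k)) → Cell X (i m)
  cellAt k i j jl jr c m = cellAtView k i j jl jr c m (snocView m)

  cellAt-last : ∀ k i j jl jr c → cellAt k i j jl jr c (fromℕ k) ≡ lastCell (chainOf k i j jl jr) c
  cellAt-last zero    i j jl jr c                                 = refl
  cellAt-last (suc k) i j jl jr c rewrite snocView-fromℕ (suc k) = refl

  cellAt-inject₁ : ∀ k i j jl jr c (m : Fin (suc k)) →
    cellAt (suc k) i j jl jr c (inject₁ m) ≡
    cellAt k (λ m → i (inject₁ m)) (λ m → j (inject₁ m)) (λ m → jl (inject₁ m)) (λ m → jr (inject₁ m)) (proj₁ c) m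
  cellAt-inject₁ k i j jl jr c m rewrite snocView-inject₁ m = refl

  cellAt-compatible : ∀ k i j jl jr c (m : Fin k) →
    iterTgt X (≤⇒≤′ (jl m)) (cellAt k i j jl jr c (inject₁ m)) ≡ iterSrc X (≤⇒≤′ (jr m)) (cellAt k i j jl jr c (fsuc m))
  cellAt-compatible (suc k) i j jl jr c m = compatibleView m (snocView m)
    where
    compatibleView : (m : Fin (suc k)) → SnocView m →
      iterTgt X (≤⇒≤′ (jl m)) (cellAt (suc k) i j jl jr c (inject₁ m)) ≡
      iterSrc X (≤⇒≤′ (jr m)) (cellAt (suc k) i j jl jr c (fsuc m))
    compatibleView .(inject₁ m′) (inner m′) =
      trans (cong (iterTgt X (≤⇒≤′ (jl (inject₁ m′)))) (cellAt-inject₁ k i j jl jr c (inject₁ m′)))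
      (trans (cellAt-compatible k (λ m → i (inject₁ m)) (λ m → j (inject₁ m)) (λ m → jl (inject₁ m))
                                  (λ m → jr (inject₁ m)) (proj₁ c) m′)
             (sym (cong (iterSrc X (≤⇒≤′ (jr (inject₁ m′)))) (cellAt-inject₁ k i j jl jr c (fsuc m′)))))
    compatibleView .(fromℕ k) last =
      trans (cong (iterTgt X (≤⇒≤′ (jl (fromℕ k))))
                  (trans (cellAt-inject₁ k i j jl jr c (fromℕ k)) (cellAt-last k _ _ _ _ (proj₁ c))))
      (trans (proj₂ (proj₂ c))
             (cong (iterSrc X (≤⇒≤′ (jr (fromℕ k)))) (sym (cellAt-last (suc k) i j jl jr c))))

  cellsFrom : ∀ k i j jl jr (cells : (m : Fin (suc k)) → Cell X (i m)) →
    (∀ m → iterTgt X (≤⇒≤′ (jl m)) (cells (inject₁ m)) ≡ iterSrc X (≤⇒≤′ (jr m)) (cells (fsuc m))) →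
    Cells (chainOf k i j jl jr) X
  lastCell-cellsFrom : ∀ k i j jl jr cells compat →
    lastCell (chainOf k i j jl jr) (cellsFrom k i j jl jr cells compat) ≡ cells (fromℕ k)
  cellsFrom zero    i j jl jr cells compat = cells fzero
  cellsFrom (suc k) i j jl jr cells compat =
    cellsFrom k _ _ _ _ (λ m → cells (inject₁ m)) (λ m → compat (inject₁ m)) ,
    cells (fromℕ (suc k)) ,
    trans (cong (iterTgt X (≤⇒≤′ (jl (fromℕ k))))
                (lastCell-cellsFrom k _ _ _ (λ m → jr (inject₁ m)) (λ m → cells (inject₁ m)) (λ m → compat (inject₁ m))))
          (compat (fromℕ k))
  lastCell-cellsFrom zero    i j jl jr cells compat = refl
  lastCell-cellsFrom (suc k) i j jl jr cells compat = refl

  cellAt-cellsFrom : ∀ k i j jl jr cells compat (m : Fin (suc k)) →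
    cellAt k i j jl jr (cellsFrom k i j jl jr cells compat) m ≡ cells m
  cellAt-cellsFrom k i j jl jr cells compat m with snocView m
  cellAt-cellsFrom zero    i j jl jr cells compat .(fromℕ zero)    | last      = refl
  cellAt-cellsFrom (suc k) i j jl jr cells compat .(inject₁ m)     | inner m   =
    cellAt-cellsFrom k _ _ _ _ (λ m → cells (inject₁ m)) (λ m → compat (inject₁ m)) m
  cellAt-cellsFrom (suc k) i j jl jr cells compat .(fromℕ (suc k)) | last      = refl

Factors⇒pointwise : ∀ k i j jl jr {X H : GSet} (c : Cells (chainOf k i j jl jr) X) e u →
  Factors (chainOf k i j jl jr) c e u → ∀ m → fun u (i m) (cellAt {X} k i j jl jr c m) ≡ cellAt {H} k i j jl jr e m
Factors⇒pointwise k i j jl jr c e u f m with snocView m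
Factors⇒pointwise zero    i j jl jr c e u f .(fromℕ zero)    | last    = f
Factors⇒pointwise (suc k) i j jl jr c e u f .(inject₁ m)     | inner m =
  Factors⇒pointwise k _ _ _ _ (proj₁ c) (proj₁ e) u (proj₁ f) m
Factors⇒pointwise (suc k) i j jl jr c e u f .(fromℕ (suc k)) | last    = proj₂ f

pointwise⇒Factors : ∀ k i j jl jr {X H : GSet} (c : Cells (chainOf k i j jl jr) X) e u →
  (∀ m → fun u (i m) (cellAt {X} k i j jl jr c m) ≡ cellAt {H} k i j jl jr e m) → Factors (chainOf k i j jl jr) c e u
pointwise⇒Factors zero    i j jl jr c e u f = f fzero
pointwise⇒Factors (suc k) i j jl jr {X} {H} c e u f =
  pointwise⇒Factors k _ _ _ _ (proj₁ c) (proj₁ e) u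
    (λ m → trans (cong (fun u _) (sym (cellAt-inject₁ {X} k i j jl jr c m)))
                 (trans (f (inject₁ m)) (cellAt-inject₁ {H} k i j jl jr e m))) ,
  trans (cong (fun u _) (sym (cellAt-last {X} (suc k) i j jl jr c)))
        (trans (f (fromℕ (suc k))) (cellAt-last {H} (suc k) i j jl jr e))

module _ (d : Diagram) where
  private
    cellAtᵈ : ∀ {X} → Cells (toChain d) X → (m : Fin (suc (len d))) → Cell X (i d m)
    cellAtᵈ = cellAt (len d) (i d) (j d) (jl d) (jr d)

  coconeOf : ∀ {X} → Cells (toChain d) X → Cocone d X
  coconeOf {X} c =
    (λ m → yoneda X (i d m) (cellAtᵈ c m)) ,
    λ m k x → begin
      yonedaFun X (i d (inject₁ m)) (cellAtᵈ c (inject₁ m)) k (τ (jl d m) k x)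
        ≡⟨ yoneda-incl true (jl d m) _ k x ⟩
      yonedaFun X (j d m) (iterTgt X (≤⇒≤′ (jl d m)) (cellAtᵈ c (inject₁ m))) k x
        ≡⟨ cong (λ w → yonedaFun X (j d m) w k x) (cellAt-compatible (len d) (i d) (j d) (jl d) (jr d) c m) ⟩
      yonedaFun X (j d m) (iterSrc X (≤⇒≤′ (jr d m)) (cellAtᵈ c (fsuc m))) k x
        ≡⟨ sym (yoneda-incl false (jr d m) _ k x) ⟩
      yonedaFun X (i d (fsuc m)) (cellAtᵈ c (fsuc m)) k (σ (jr d m) k x) ∎

  -- A cocone under d is determined by the images of the top cells of its disks.
  chainColimit⇒colimit : ∀ {X} (c : Cells (toChain d) X) → IsChainColimit (toChain d) X c →
                         IsColimit d X (coconeOf c)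
  chainColimit⇒colimit {X} c colim H (e , e-compat) = u , factors , unique
    where
    cells : (m : Fin (suc (len d))) → Cell H (i d m)
    cells m = fun (e m) (i d m) (xₙ (i d m))

    compat : ∀ m → iterTgt H (≤⇒≤′ (jl d m)) (cells (inject₁ m)) ≡ iterSrc H (≤⇒≤′ (jr d m)) (cells (fsuc m))
    compat m = begin
      iterTgt H pl (fun (e (inject₁ m)) iₗ (xₙ iₗ))            ≡⟨ sym (iterTgt-natural (e (inject₁ m)) pl (xₙ iₗ)) ⟩
      fun (e (inject₁ m)) (j d m) (iterTgt (D iₗ) pl (xₙ iₗ))  ≡⟨ cong (fun (e (inject₁ m)) (j d m)) (sym (incl-xₙ true (jl d m))) ⟩
      fun (e (inject₁ m)) (j d m) (τ (jl d m) _ (xₙ (j d m)))  ≡⟨ e-compat m (j d m) (xₙ (j d m)) ⟩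
      fun (e (fsuc m)) (j d m) (σ (jr d m) _ (xₙ (j d m)))     ≡⟨ cong (fun (e (fsuc m)) (j d m)) (incl-xₙ false (jr d m)) ⟩
      fun (e (fsuc m)) (j d m) (iterSrc (D iᵣ) pr (xₙ iᵣ))     ≡⟨ iterSrc-natural (e (fsuc m)) pr (xₙ iᵣ) ⟩
      iterSrc H pr (fun (e (fsuc m)) iᵣ (xₙ iᵣ))               ∎
      where
      iₗ iᵣ : ℕ
      iₗ = i d (inject₁ m)
      iᵣ = i d (fsuc m)
      pl : j d m ≤′ iₗ
      pl = ≤⇒≤′ (jl d m)
      pr : j d m ≤′ iᵣ
      pr = ≤⇒≤′ (jr d m)

    e′ : Cells (toChain d) H
    e′ = cellsFrom (len d) (i d) (j d) (jl d) (jr d) cells compat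

    u : GMor X H
    u = proj₁ (colim H e′)

    u-factors : Factors (toChain d) c e′ u
    u-factors = proj₁ (proj₂ (colim H e′))

    u-unique : (u′ : GMor X H) → Factors (toChain d) c e′ u′ → ∀ n x → fun u n x ≡ fun u′ n x
    u-unique = proj₂ (proj₂ (colim H e′))

    u-cellAt : ∀ m → fun u (i d m) (cellAtᵈ c m) ≡ cells m
    u-cellAt m = trans (Factors⇒pointwise (len d) (i d) (j d) (jl d) (jr d) c e′ u u-factors m)
                       (cellAt-cellsFrom (len d) _ _ _ _ cells compat m)

    factors : ∀ m n x → fun u n (fun (proj₁ (coconeOf c) m) n x) ≡ fun (e m) n x
    factors m n x = begin
      fun u n (yonedaFun X (i d m) (cellAtᵈ c m) n x)   ≡⟨ yoneda-natural {X} {H} {i d m} u _ n x ⟩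
      yonedaFun H (i d m) (fun u _ (cellAtᵈ c m)) n x   ≡⟨ cong (λ w → yonedaFun H (i d m) w n x) (u-cellAt m) ⟩
      yonedaFun H (i d m) (cells m) n x                  ≡⟨ sym (yoneda-unique {H} {i d m} (e m) n x) ⟩
      fun (e m) n x                                      ∎

    unique : (u′ : GMor X H) → (∀ m n x → fun u′ n (fun (proj₁ (coconeOf c) m) n x) ≡ fun (e m) n x) →
             ∀ n x → fun u n x ≡ fun u′ n x
    unique u′ f′ = u-unique u′
      (pointwise⇒Factors (len d) (i d) (j d) (jl d) (jr d) c e′ u′
        (λ m → trans (cong (fun u′ (i d m)) (sym (yoneda-top X (i d m) _)))
                     (trans (f′ m (i d m) (xₙ (i d m))) (sym (cellAt-cellsFrom (len d) _ _ _ _ cells compat m)))))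

-- The globular set G^Γ

-- The local functions memT, srcT, tgtT of G^, which are not exported.
memOf : Maybe Ty → ℕ → Bool
memOf (just A) n = dim A ≡ᵇ n
memOf nothing  n = false

srcOf tgtOf : Maybe Ty → Var → Var
srcOf (just (Hom A y z)) _ = y
srcOf _                  v = v
tgtOf (just (Hom A y z)) _ = z
tgtOf _                  v = v

mem-G^ : ∀ Γ n v → mem (G^ Γ) n v ≡ memOf (lookupVar Γ v) n
mem-G^ Γ n v with lookupVar Γ v
... | just A  = refl
... | nothing = refl

src-G^ : ∀ Γ n v → src (G^ Γ) n v ≡ srcOf (lookupVar Γ v) v
src-G^ Γ n v with lookupVar Γ v
... | just ⋆           = refl
... | just (Hom A y z) = refl
... | nothing          = refl

tgt-G^ : ∀ Γ n v → tgt (G^ Γ) n v ≡ tgtOf (lookupVar Γ v) v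
tgt-G^ Γ n v with lookupVar Γ v
... | just ⋆           = refl
... | just (Hom A y z) = refl
... | nothing          = refl

nothing≢just : ∀ {B : Ty} → nothing ≢ just B
nothing≢just ()

mem⇒declared : ∀ Γ n v → T (mem (G^ Γ) n v) → Σ Ty λ B → lookupVar Γ v ≡ just B × dim B ≡ n
mem⇒declared Γ n v v∈ = go (lookupVar Γ v) (subst T (mem-G^ Γ n v) v∈)
  where
  go : ∀ m → T (memOf m n) → Σ Ty λ B → m ≡ just B × dim B ≡ n
  go (just B) v∈′ = B , refl , ≡ᵇ⇒≡ (dim B) n v∈′

declared⇒mem : ∀ Γ v B n → lookupVar Γ v ≡ just B → dim B ≡ n → T (mem (G^ Γ) n v)
declared⇒mem Γ v B n eq refl =
  subst T (sym (trans (mem-G^ Γ (dim B) v) (cong (λ m → memOf m (dim B)) eq))) (≡⇒≡ᵇ (dim B) (dim B) refl)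

src-declared : ∀ Γ n v B a b → lookupVar Γ v ≡ just (Hom B a b) → src (G^ Γ) n v ≡ a
src-declared Γ n v B a b eq = trans (src-G^ Γ n v) (cong (λ m → srcOf m v) eq)

tgt-declared : ∀ Γ n v B a b → lookupVar Γ v ≡ just (Hom B a b) → tgt (G^ Γ) n v ≡ b
tgt-declared Γ n v B a b eq = trans (tgt-G^ Γ n v) (cong (λ m → tgtOf m v) eq)

G^-disjoint : ∀ Γ → Disjoint (G^ Γ)
G^-disjoint Γ n m v v∈n v∈m with mem⇒declared Γ n v v∈n | mem⇒declared Γ m v v∈m
... | B , eq , refl | B′ , eq′ , refl = cong dim (just-injective (trans (sym eq) eq′))

lookup-here : ∀ Γ v A → lookupVar (Γ ▸ v ∶ A) v ≡ just A
lookup-here Γ v A with v ≟ v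
... | yes _ = refl
... | no ne = ⊥-elim (ne refl)

lookup-there : ∀ Γ v x A → v ≢ x → lookupVar (Γ ▸ x ∶ A) v ≡ lookupVar Γ v
lookup-there Γ v x A ne with v ≟ x
... | yes e = ⊥-elim (ne e)
... | no _  = refl

lookup-fresh : ∀ Γ v → v ∉FV Γ → lookupVar Γ v ≡ nothing
lookup-fresh ∅           v v∉ = refl
lookup-fresh (Γ ▸ x ∶ A) v v∉ with v ≟ x
... | yes e = ⊥-elim (v∉ (inj₂ (inj₁ e)))
... | no _  = lookup-fresh Γ v (λ h → v∉ (inj₁ h))

declared⇒∈FV : ∀ Γ v B → lookupVar Γ v ≡ just B → v ∈FV Γ
declared⇒∈FV ∅           v B ()
declared⇒∈FV (Γ ▸ x ∶ A) v B eq with v ≟ x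
... | yes e = inj₂ (inj₁ e)
... | no _  = inj₁ (declared⇒∈FV Γ v B eq)

declared≢fresh : ∀ Γ v y B → lookupVar Γ v ≡ just B → y ∉FV Γ → v ≢ y
declared≢fresh Γ v y B eq y∉ refl = y∉ (declared⇒∈FV Γ v B eq)

∈Ty⇒∈FV : ∀ Γ x A v → lookupVar Γ x ≡ just A → v ∈Ty A → v ∈FV Γ
∈Ty⇒∈FV ∅           x A v () h
∈Ty⇒∈FV (Γ ▸ z ∶ B) x A v eq h with x ≟ z
∈Ty⇒∈FV (Γ ▸ z ∶ B) x A v refl h | yes _ = inj₂ (inj₂ h)
∈Ty⇒∈FV (Γ ▸ z ∶ B) x A v eq   h | no _  = inj₁ (∈Ty⇒∈FV Γ x A v eq h)

WellFormed : Ctx → Set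
WellFormed Γ = ∀ v B a b → lookupVar Γ v ≡ just (Hom B a b) → lookupVar Γ a ≡ just B × lookupVar Γ b ≡ just B

G^-isGlobular : ∀ Γ → WellFormed Γ → IsGlobular (G^ Γ)
G^-isGlobular Γ wf = record { src-in = src-in′ ; tgt-in = tgt-in′ ; glob-s = glob-s′ ; glob-t = glob-t′ }
  where
  src-in′ : ∀ n v → T (mem (G^ Γ) (suc n) v) → T (mem (G^ Γ) n (src (G^ Γ) n v))
  src-in′ n v v∈ with mem⇒declared Γ (suc n) v v∈
  ... | Hom B a b , eq , refl =
    subst (λ z → T (mem (G^ Γ) n z)) (sym (src-declared Γ n v B a b eq)) (declared⇒mem Γ a B n (proj₁ (wf v B a b eq)) refl)

  tgt-in′ : ∀ n v → T (mem (G^ Γ) (suc n) v) → T (mem (G^ Γ) n (tgt (G^ Γ) n v))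
  tgt-in′ n v v∈ with mem⇒declared Γ (suc n) v v∈
  ... | Hom B a b , eq , refl =
    subst (λ z → T (mem (G^ Γ) n z)) (sym (tgt-declared Γ n v B a b eq)) (declared⇒mem Γ b B n (proj₂ (wf v B a b eq)) refl)

  glob-s′ : ∀ n v → T (mem (G^ Γ) (suc (suc n)) v) →
            src (G^ Γ) n (src (G^ Γ) (suc n) v) ≡ src (G^ Γ) n (tgt (G^ Γ) (suc n) v)
  glob-s′ n v v∈ with mem⇒declared Γ (suc (suc n)) v v∈
  ... | Hom (Hom C c d) a b , eq , refl =
    trans (cong (src (G^ Γ) n) (src-declared Γ (suc n) v _ a b eq))
    (trans (src-declared Γ n a C c d (proj₁ (wf v _ a b eq)))
    (sym (trans (cong (src (G^ Γ) n) (tgt-declared Γ (suc n) v _ a b eq))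
                (src-declared Γ n b C c d (proj₂ (wf v _ a b eq))))))

  glob-t′ : ∀ n v → T (mem (G^ Γ) (suc (suc n)) v) →
            tgt (G^ Γ) n (src (G^ Γ) (suc n) v) ≡ tgt (G^ Γ) n (tgt (G^ Γ) (suc n) v)
  glob-t′ n v v∈ with mem⇒declared Γ (suc (suc n)) v v∈
  ... | Hom (Hom C c d) a b , eq , refl =
    trans (cong (tgt (G^ Γ) n) (src-declared Γ (suc n) v _ a b eq))
    (trans (tgt-declared Γ n a C c d (proj₁ (wf v _ a b eq)))
    (sym (trans (cong (tgt (G^ Γ) n) (tgt-declared Γ (suc n) v _ a b eq))
                (tgt-declared Γ n b C c d (proj₂ (wf v _ a b eq))))))

GSetOf : (Γ : Ctx) → WellFormed Γ → GSet
GSetOf Γ wf = toGSet (G^ Γ) (G^-isGlobular Γ wf)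

cell-≡ : ∀ {V : VGSet} {w : IsGlobular V} {n} {a b : Cell (toGSet V w) n} → proj₁ a ≡ proj₁ b → a ≡ b
cell-≡ {a = v , p} {b = .v , q} refl = cong (v ,_) (T-irrelevant p q)

subst-refl : ∀ {H : GSet} {m} (e : m ≡ m) (c : Cell H m) → subst (Cell H) e c ≡ c
subst-refl {H} e c = cong (λ e′ → subst (Cell H) e′ c) (≡-irrelevant e refl)

_⊑_ : Ctx → Ctx → Set
Γ ⊑ Γ′ = ∀ v B → lookupVar Γ v ≡ just B → lookupVar Γ′ v ≡ just B

⊑-mem : ∀ Γ Γ′ → Γ ⊑ Γ′ → ∀ n v → T (mem (G^ Γ) n v) → T (mem (G^ Γ′) n v)
⊑-mem Γ Γ′ inc n v v∈ with mem⇒declared Γ n v v∈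
... | B , eq , de = declared⇒mem Γ′ v B n (inc v B eq) de

⊑-lookup : ∀ Γ Γ′ → Γ ⊑ Γ′ → ∀ n v → T (mem (G^ Γ) n v) → lookupVar Γ′ v ≡ lookupVar Γ v
⊑-lookup Γ Γ′ inc n v v∈ with mem⇒declared Γ n v v∈
... | B , eq , de = trans (inc v B eq) (sym eq)

⊑⇒GMor : ∀ Γ Γ′ wf wf′ → Γ ⊑ Γ′ → GMor (GSetOf Γ wf) (GSetOf Γ′ wf′)
⊑⇒GMor Γ Γ′ wf wf′ inc = record
  { fun = λ n c → proj₁ c , ⊑-mem Γ Γ′ inc n (proj₁ c) (proj₂ c)
  ; fs  = λ n c → cell-≡ {G^ Γ′} {G^-isGlobular Γ′ wf′}
            (sym (trans (src-G^ Γ′ n (proj₁ c))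
                 (trans (cong (λ m → srcOf m (proj₁ c)) (⊑-lookup Γ Γ′ inc (suc n) (proj₁ c) (proj₂ c)))
                        (sym (src-G^ Γ n (proj₁ c))))))
  ; ft  = λ n c → cell-≡ {G^ Γ′} {G^-isGlobular Γ′ wf′}
            (sym (trans (tgt-G^ Γ′ n (proj₁ c))
                 (trans (cong (λ m → tgtOf m (proj₁ c)) (⊑-lookup Γ Γ′ inc (suc n) (proj₁ c) (proj₂ c)))
                        (sym (tgt-G^ Γ n (proj₁ c))))))
  }

mem⇒level : ∀ Γ k v C → lookupVar Γ v ≡ just C → T (mem (G^ Γ) k v) → k ≡ dim C
mem⇒level Γ k v C eq v∈ with mem⇒declared Γ k v v∈
... | B , eq′ , refl = cong dim (just-injective (trans (sym eq′) eq))

fresh⇒¬mem : ∀ Γ k v → v ∉FV Γ → ¬ T (mem (G^ Γ) k v)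
fresh⇒¬mem Γ k v v∉ v∈ with mem⇒declared Γ k v v∈
... | B , eq , _ = nothing≢just (trans (sym (lookup-fresh Γ v v∉)) eq)

bd-sameType : ∀ Γ Δ a b A k → lookupVar Γ a ≡ just A → lookupVar Δ b ≡ just A → dim A ≡ suc k →
              src (G^ Γ) k a ≡ src (G^ Δ) k b × tgt (G^ Γ) k a ≡ tgt (G^ Δ) k b
bd-sameType Γ Δ a b (Hom B c d) k a∶A b∶A _ =
  trans (src-declared Γ k a B c d a∶A) (sym (src-declared Δ k b B c d b∶A)) ,
  trans (tgt-declared Γ k a B c d a∶A) (sym (tgt-declared Δ k b B c d b∶A))

mapCells : ∀ {l} (L : Chain l) {X Y} → GMor X Y → Cells L X → Cells L Y
lastCell-mapCells : ∀ {l} (L : Chain l) {X Y} (v : GMor X Y) (c : Cells L X) →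
                    lastCell L (mapCells L v c) ≡ fun v l (lastCell L c)
mapCells (base a)         v c = fun v a c
mapCells (step L j i p q) {X} {Y} v (c , h , compat) =
  mapCells L v c , fun v i h ,
  (begin
    iterTgt Y (≤⇒≤′ p) (lastCell L (mapCells L v c))   ≡⟨ cong (iterTgt Y (≤⇒≤′ p)) (lastCell-mapCells L v c) ⟩
    iterTgt Y (≤⇒≤′ p) (fun v _ (lastCell L c))        ≡⟨ sym (iterTgt-natural v (≤⇒≤′ p) (lastCell L c)) ⟩
    fun v j (iterTgt X (≤⇒≤′ p) (lastCell L c))        ≡⟨ cong (fun v j) compat ⟩
    fun v j (iterSrc X (≤⇒≤′ q) h)                     ≡⟨ iterSrc-natural v (≤⇒≤′ q) h ⟩
    iterSrc Y (≤⇒≤′ q) (fun v i h)                     ∎)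
lastCell-mapCells (base a)         v c = refl
lastCell-mapCells (step L j i p q) v c = refl

Factors-mapCells⇒ : ∀ {l} (L : Chain l) {X Y H} (v : GMor X Y) (c : Cells L X) (e : Cells L H) (u : GMor Y H) →
                    Factors L (mapCells L v c) e u → Factors L c e (u ∘ᴹ v)
Factors-mapCells⇒ (base a)         v c       e       u f       = f
Factors-mapCells⇒ (step L j i p q) v (c , _) (e , _) u (f , g) = Factors-mapCells⇒ L v c e u f , g

Factors-mapCells⇐ : ∀ {l} (L : Chain l) {X Y H} (v : GMor X Y) (c : Cells L X) (e : Cells L H) (u : GMor Y H) →
                    Factors L c e (u ∘ᴹ v) → Factors L (mapCells L v c) e u
Factors-mapCells⇐ (base a)         v c       e       u f       = f
Factors-mapCells⇐ (step L j i p q) v (c , _) (e , _) u (f , g) = Factors-mapCells⇐ L v c e u f , g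

grow : ∀ {l} → Chain l → Chain (suc l)
grow (base a)         = base (suc a)
grow (step L j i p q) = step L j (suc i) p (m≤n⇒m≤1+n q)

iterSrc-grow : ∀ (X : GSet) {j i} (q : j ≤ i) (h : Cell X (suc i)) →
               iterSrc X (≤⇒≤′ (m≤n⇒m≤1+n q)) h ≡ iterSrc X (≤⇒≤′ q) (s X i h)
iterSrc-grow X q h = cong (λ r → iterSrc X r h) (≤′-irrelevant (≤⇒≤′ (m≤n⇒m≤1+n q)) (≤′-step (≤⇒≤′ q)))

growCells : ∀ {l} (L : Chain l) {X} (c : Cells L X) (h : Cell X (suc l)) → s X l h ≡ lastCell L c → Cells (grow L) X
growCells (base a)         c           h sh = h
growCells (step L j i p q) {X} (c , _ , compat) h sh =
  c , h , trans compat (sym (trans (iterSrc-grow X q h) (cong (iterSrc X (≤⇒≤′ q)) sh)))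

lastCell-growCells : ∀ {l} (L : Chain l) {X} (c : Cells L X) h sh → lastCell (grow L) (growCells L {X} c h sh) ≡ h
lastCell-growCells (base a)         c h sh = refl
lastCell-growCells (step L j i p q) c h sh = refl

shrinkCells : ∀ {l} (L : Chain l) {H} → Cells (grow L) H → Cells L H
shrinkCells (base a)         {H} e                = s H a e
shrinkCells (step L j i p q) {H} (e , k , compat) = e , s H i k , trans compat (iterSrc-grow H q k)

lastCell-shrinkCells : ∀ {l} (L : Chain l) {H} (e : Cells (grow L) H) →
                       lastCell L (shrinkCells L e) ≡ s H l (lastCell (grow L) e)
lastCell-shrinkCells (base a)         e = refl
lastCell-shrinkCells (step L j i p q) e = refl

Factors-growCells⇒ : ∀ {l} (L : Chain l) {X H} (c : Cells L X) h sh (e : Cells (grow L) H) (u : GMor X H) →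
                     Factors (grow L) (growCells L c h sh) e u → Factors L c (shrinkCells L e) u
Factors-growCells⇒ (base a) {X} {H} c h sh e u f =
  trans (cong (fun u a) (sym sh)) (trans (fs u a h) (cong (s H a) f))
Factors-growCells⇒ (step L j i p q) {X} {H} (c , _) h sh (e , _) u (f , g) =
  f , trans (cong (fun u i) (sym sh)) (trans (fs u i h) (cong (s H i) g))

Factors-growCells⇐ : ∀ {l} (L : Chain l) {X H} (c : Cells L X) h sh (e : Cells (grow L) H) (u : GMor X H) →
                     Factors L c (shrinkCells L e) u → fun u (suc l) h ≡ lastCell (grow L) e →
                     Factors (grow L) (growCells L c h sh) e u
Factors-growCells⇐ (base a)         c       h sh e       u f       g = g
Factors-growCells⇐ (step L j i p q) (c , _) h sh (e , _) u (f , _) g = f , g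

degenerateCells : ∀ {l} (L : Chain l) {X} (c : Cells L X) {j} (p : j ≤ l) → Cells (step L j j p ≤-refl) X
degenerateCells L {X} c p = c , iterTgt X (≤⇒≤′ p) (lastCell L c) , sym (iter∂-refl X false (≤⇒≤′ ≤-refl) _)

degenerate-isColimit : ∀ {l} (L : Chain l) {X} (c : Cells L X) → IsChainColimit L X c → ∀ {j} (p : j ≤ l) →
                       IsChainColimit (step L j j p ≤-refl) X (degenerateCells L c p)
degenerate-isColimit L {X} c colim {j} p H (e , k , compat) =
  u , (u-factors , u-last) , λ u′ f′ → proj₂ (proj₂ (colim H e)) u′ (proj₁ f′)
  where
  u : GMor X H
  u = proj₁ (colim H e)
  u-factors : Factors L c e u
  u-factors = proj₁ (proj₂ (colim H e))
  u-last : fun u j (iterTgt X (≤⇒≤′ p) (lastCell L c)) ≡ k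
  u-last = begin
    fun u j (iterTgt X (≤⇒≤′ p) (lastCell L c))   ≡⟨ iterTgt-natural u (≤⇒≤′ p) (lastCell L c) ⟩
    iterTgt H (≤⇒≤′ p) (fun u _ (lastCell L c))   ≡⟨ cong (iterTgt H (≤⇒≤′ p)) (Factors-last L c e u u-factors) ⟩
    iterTgt H (≤⇒≤′ p) (lastCell L e)             ≡⟨ compat ⟩
    iterSrc H (≤⇒≤′ ≤-refl) k                      ≡⟨ iter∂-refl H false (≤⇒≤′ ≤-refl) k ⟩
    k                                              ∎

-- Extending a context by y : A and f : Hom_A(x, y)

module Snoc (Γ : Ctx) (x : Var) (A : Ty) (y f : Var) (x∶A : lookupVar Γ x ≡ just A)
            (y∉ : y ∉FV Γ) (f∉ : f ∉FV Γ) (y≢f : y ≢ f) where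

  Γ′ : Ctx
  Γ′ = Γ ▸ y ∶ A ▸ f ∶ Hom A x y

  lookup-f : lookupVar Γ′ f ≡ just (Hom A x y)
  lookup-f = lookup-here (Γ ▸ y ∶ A) f (Hom A x y)

  lookup-y : lookupVar Γ′ y ≡ just A
  lookup-y = trans (lookup-there (Γ ▸ y ∶ A) y f (Hom A x y) y≢f) (lookup-here Γ y A)

  lookup-old : ∀ v → v ≢ y → v ≢ f → lookupVar Γ′ v ≡ lookupVar Γ v
  lookup-old v v≢y v≢f = trans (lookup-there (Γ ▸ y ∶ A) v f (Hom A x y) v≢f) (lookup-there Γ v y A v≢y)

  Γ⊑Γ′ : Γ ⊑ Γ′
  Γ⊑Γ′ v B eq = trans (lookup-old v (declared≢fresh Γ v y B eq y∉) (declared≢fresh Γ v f B eq f∉)) eq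

  x≢y : x ≢ y
  x≢y = declared≢fresh Γ x y A x∶A y∉

  x≢f : x ≢ f
  x≢f = declared≢fresh Γ x f A x∶A f∉

  data Kind : Var → Set where
    is-f : Kind f
    is-y : Kind y
    old  : ∀ {v} → v ≢ y → v ≢ f → Kind v

  kind : ∀ v → Kind v
  kind v with v ≟ f | v ≟ y
  ... | yes refl | _        = is-f
  ... | no _     | yes refl = is-y
  ... | no v≢f   | no v≢y   = old v≢y v≢f

  lookup-old′ : ∀ {v B} → v ≢ y → v ≢ f → lookupVar Γ′ v ≡ just B → lookupVar Γ v ≡ just B
  lookup-old′ {v} v≢y v≢f eq = trans (sym (lookup-old v v≢y v≢f)) eq

  wellFormed : WellFormed Γ → WellFormed Γ′
  wellFormed wf v B a b eq with kind v
  ... | is-f with trans (sym lookup-f) eq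
  ...   | refl = Γ⊑Γ′ x A x∶A , lookup-y
  wellFormed wf v B a b eq | is-y with trans (sym lookup-y) eq
  ...   | refl = Γ⊑Γ′ a B (proj₁ (wf x B a b x∶A)) , Γ⊑Γ′ b B (proj₂ (wf x B a b x∶A))
  wellFormed wf v B a b eq | old v≢y v≢f =
    Γ⊑Γ′ a B (proj₁ (wf v B a b (lookup-old′ v≢y v≢f eq))) , Γ⊑Γ′ b B (proj₂ (wf v B a b (lookup-old′ v≢y v≢f eq)))

-- n is a parameter rather than a definition of dim A, so that levels can be matched against it.
module Extension (Γ : Ctx) (x : Var) (A : Ty) (y f : Var) (x∶A : lookupVar Γ x ≡ just A) (wf : WellFormed Γ)
                 (y∉ : y ∉FV Γ) (f∉ : f ∉FV Γ) (y≢f : y ≢ f) (n : ℕ) (dimA : dim A ≡ n) where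

  open Snoc Γ x A y f x∶A y∉ f∉ y≢f public

  wf′ : WellFormed Γ′
  wf′ = wellFormed wf

  X X′ : GSet
  X  = GSetOf Γ wf
  X′ = GSetOf Γ′ wf′

  ι : GMor X X′
  ι = ⊑⇒GMor Γ Γ′ wf wf′ Γ⊑Γ′

  xC : Cell X n
  xC = x , declared⇒mem Γ x A n x∶A dimA

  yC : Cell X′ n
  yC = y , declared⇒mem Γ′ y A n lookup-y dimA

  fC : Cell X′ (suc n)
  fC = f , declared⇒mem Γ′ f (Hom A x y) (suc n) lookup-f (cong suc dimA)

  level-f : ∀ k → T (mem (G^ Γ′) k f) → k ≡ suc n
  level-f k f∈ = trans (mem⇒level Γ′ k f (Hom A x y) lookup-f f∈) (cong suc dimA)

  level-y : ∀ k → T (mem (G^ Γ′) k y) → k ≡ n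
  level-y k y∈ = trans (mem⇒level Γ′ k y A lookup-y y∈) dimA

  old-mem : ∀ k v → v ≢ y → v ≢ f → T (mem (G^ Γ′) k v) → T (mem (G^ Γ) k v)
  old-mem k v v≢y v≢f = subst T (trans (mem-G^ Γ′ k v) (trans (cong (λ m → memOf m k) (lookup-old v v≢y v≢f)) (sym (mem-G^ Γ k v))))

  old-cell : ∀ k v (v∈ : T (mem (G^ Γ′) k v)) v≢y v≢f → (v , v∈) ≡ fun ι k (v , old-mem k v v≢y v≢f v∈)
  old-cell k v v∈ v≢y v≢f = cell-≡ {G^ Γ′} {G^-isGlobular Γ′ wf′} refl

  s-f : ∀ {f∈} → s X′ n (f , f∈) ≡ fun ι n xC
  s-f = cell-≡ {G^ Γ′} {G^-isGlobular Γ′ wf′} (src-declared Γ′ n f A x y lookup-f)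

  t-f : ∀ {f∈} → t X′ n (f , f∈) ≡ yC
  t-f = cell-≡ {G^ Γ′} {G^-isGlobular Γ′ wf′} (tgt-declared Γ′ n f A x y lookup-f)

  -- y is parallel to x.
  ∂-y : ∀ b k (e : suc k ≡ n) (y∈ : T (mem (G^ Γ′) (suc k) y)) →
        ∂ X′ b k (y , y∈) ≡ fun ι k (∂ X b k (subst (Cell X) (sym e) xC))
  ∂-y false k refl y∈ = cell-≡ {G^ Γ′} {G^-isGlobular Γ′ wf′} (proj₁ (bd-sameType Γ′ Γ y x A k lookup-y x∶A dimA))
  ∂-y true  k refl y∈ = cell-≡ {G^ Γ′} {G^-isGlobular Γ′ wf′} (proj₂ (bd-sameType Γ′ Γ y x A k lookup-y x∶A dimA))

  -- G^Γ′ is the pushout of G^Γ along the source inclusion D_n → D_{n+1} at x: a morphism out of it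
  -- is a morphism u out of G^Γ together with an (n+1)-cell φ of source u(x).
  module Universal {H : GSet} (u : GMor X H) (φ : Cell H (suc n)) (sφ : s H n φ ≡ fun u n xC) where

    extendAt : ∀ k v → T (mem (G^ Γ′) k v) → Kind v → Cell H k
    extendAt k .f f∈ is-f          = subst (Cell H) (sym (level-f k f∈)) φ
    extendAt k .y y∈ is-y          = subst (Cell H) (sym (level-y k y∈)) (t H n φ)
    extendAt k v  v∈ (old v≢y v≢f) = fun u k (v , old-mem k v v≢y v≢f v∈)

    extendFun : ∀ k → Cell X′ k → Cell H k
    extendFun k (v , v∈) = extendAt k v v∈ (kind v)

    extend-ι : ∀ k c → extendFun k (fun ι k c) ≡ fun u k c
    extend-ι k (v , v∈) with kind v
    ... | is-f          = ⊥-elim (fresh⇒¬mem Γ k f f∉ v∈)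
    ... | is-y          = ⊥-elim (fresh⇒¬mem Γ k y y∉ v∈)
    ... | old v≢y v≢f   = cong (fun u k) (cell-≡ {G^ Γ} {G^-isGlobular Γ wf} refl)

    extend-f : ∀ k f∈ (e : k ≡ suc n) → extendFun k (f , f∈) ≡ subst (Cell H) (sym e) φ
    extend-f k f∈ e with kind f
    ... | is-f        = cong (λ e′ → subst (Cell H) e′ φ) (≡-irrelevant _ _)
    ... | is-y        = ⊥-elim (y≢f refl)
    ... | old _ f≢f   = ⊥-elim (f≢f refl)

    extend-y : ∀ k y∈ (e : k ≡ n) → extendFun k (y , y∈) ≡ subst (Cell H) (sym e) (t H n φ)
    extend-y k y∈ e with kind y
    ... | is-f        = ⊥-elim (y≢f refl)
    ... | is-y        = cong (λ e′ → subst (Cell H) e′ (t H n φ)) (≡-irrelevant _ _)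
    ... | old y≢y _   = ⊥-elim (y≢y refl)

    extend-∂-f : ∀ b (f∈ : T (mem (G^ Γ′) (suc n) f)) →
                 extendFun n (∂ X′ b n (f , f∈)) ≡ ∂ H b n (extendFun (suc n) (f , f∈))
    extend-∂-f false f∈ = begin
      extendFun n (s X′ n (f , f∈))         ≡⟨ cong (extendFun n) s-f ⟩
      extendFun n (fun ι n xC)              ≡⟨ extend-ι n xC ⟩
      fun u n xC                            ≡⟨ sym sφ ⟩
      s H n φ                               ≡⟨ cong (s H n) (sym (extend-f (suc n) f∈ refl)) ⟩
      s H n (extendFun (suc n) (f , f∈))    ∎
    extend-∂-f true f∈ = begin
      extendFun n (t X′ n (f , f∈))         ≡⟨ cong (extendFun n) t-f ⟩
      extendFun n yC                        ≡⟨ extend-y n (proj₂ yC) refl ⟩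
      t H n φ                               ≡⟨ cong (t H n) (sym (extend-f (suc n) f∈ refl)) ⟩
      t H n (extendFun (suc n) (f , f∈))    ∎

    extend-∂-y : ∀ b k (e : suc k ≡ n) (y∈ : T (mem (G^ Γ′) (suc k) y)) →
                 extendFun k (∂ X′ b k (y , y∈)) ≡ ∂ H b k (extendFun (suc k) (y , y∈))
    extend-∂-y b k refl y∈ = begin
      extendFun k (∂ X′ b k (y , y∈))        ≡⟨ cong (extendFun k) (∂-y b k refl y∈) ⟩
      extendFun k (fun ι k (∂ X b k xC))     ≡⟨ extend-ι k (∂ X b k xC) ⟩
      fun u k (∂ X b k xC)                   ≡⟨ ∂-natural u b k xC ⟩
      ∂ H b k (fun u (suc k) xC)             ≡⟨ cong (∂ H b k) (sym sφ) ⟩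
      ∂ H b k (s H (suc k) φ)                ≡⟨ sym (∂-∘-t H b false φ) ⟩
      ∂ H b k (t H (suc k) φ)                ≡⟨ cong (∂ H b k) (sym (extend-y (suc k) y∈ refl)) ⟩
      ∂ H b k (extendFun (suc k) (y , y∈))   ∎

    extend-∂ : ∀ b k c → extendFun k (∂ X′ b k c) ≡ ∂ H b k (extendFun (suc k) c)
    extend-∂ b k (v , v∈) = by-kind (kind v)
      where
      by-kind : Kind v → extendFun k (∂ X′ b k (v , v∈)) ≡ ∂ H b k (extendFun (suc k) (v , v∈))
      by-kind is-f with level-f (suc k) v∈
      ... | refl = extend-∂-f b v∈
      by-kind is-y = extend-∂-y b k (level-y (suc k) v∈) v∈
      by-kind (old v≢y v≢f) = begin
        extendFun k (∂ X′ b k (v , v∈))      ≡⟨ cong (λ c → extendFun k (∂ X′ b k c)) (old-cell (suc k) v v∈ v≢y v≢f) ⟩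
        extendFun k (∂ X′ b k (fun ι _ c))   ≡⟨ cong (extendFun k) (sym (∂-natural ι b k c)) ⟩
        extendFun k (fun ι k (∂ X b k c))    ≡⟨ extend-ι k (∂ X b k c) ⟩
        fun u k (∂ X b k c)                  ≡⟨ ∂-natural u b k c ⟩
        ∂ H b k (fun u (suc k) c)            ≡⟨ cong (∂ H b k) (sym (extend-ι (suc k) c)) ⟩
        ∂ H b k (extendFun (suc k) (fun ι _ c))
          ≡⟨ cong (λ c′ → ∂ H b k (extendFun (suc k) c′)) (sym (old-cell (suc k) v v∈ v≢y v≢f)) ⟩
        ∂ H b k (extendFun (suc k) (v , v∈)) ∎
        where
        c : Cell X (suc k)
        c = v , old-mem (suc k) v v≢y v≢f v∈

    extend : GMor X′ H
    extend = record { fun = extendFun ; fs = extend-∂ false ; ft = extend-∂ true }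

    extend-unique : (u′ : GMor X′ H) → (∀ k c → fun u′ k (fun ι k c) ≡ fun u k c) → fun u′ (suc n) fC ≡ φ →
                    ∀ k c → extendFun k c ≡ fun u′ k c
    extend-unique u′ u′ι u′f k (v , v∈) with kind v
    ... | is-f = on-f k v∈ (level-f k v∈)
      where
      on-f : ∀ k (f∈ : T (mem (G^ Γ′) k f)) (e : k ≡ suc n) → subst (Cell H) (sym e) φ ≡ fun u′ k (f , f∈)
      on-f k f∈ refl = trans (sym u′f) (cong (fun u′ (suc n)) (cell-≡ {G^ Γ′} {G^-isGlobular Γ′ wf′} refl))
    ... | is-y = on-y k v∈ (level-y k v∈)
      where
      on-y : ∀ k (y∈ : T (mem (G^ Γ′) k y)) (e : k ≡ n) → subst (Cell H) (sym e) (t H n φ) ≡ fun u′ k (y , y∈)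
      on-y k y∈ refl = begin
        t H n φ                      ≡⟨ cong (t H n) (sym u′f) ⟩
        t H n (fun u′ (suc n) fC)    ≡⟨ sym (ft u′ n fC) ⟩
        fun u′ n (t X′ n fC)         ≡⟨ cong (fun u′ n) (trans t-f (cell-≡ {G^ Γ′} {G^-isGlobular Γ′ wf′} refl)) ⟩
        fun u′ n (y , y∈)            ∎
    ... | old v≢y v≢f =
      trans (sym (u′ι k (v , old-mem k v v≢y v≢f v∈))) (cong (fun u′ k) (sym (old-cell k v v∈ v≢y v≢f)))

  open Universal using (extend; extend-ι; extend-f; extend-unique)

  extendCells : (L : Chain n) (c : Cells L X) → lastCell L c ≡ xC → Cells (grow L) X′
  extendCells L c c-last = growCells L (mapCells L ι c) fC
    (trans s-f (sym (trans (lastCell-mapCells L ι c) (cong (fun ι n) c-last))))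

  lastCell-extendCells : (L : Chain n) (c : Cells L X) (c-last : lastCell L c ≡ xC) →
                         lastCell (grow L) (extendCells L c c-last) ≡ fC
  lastCell-extendCells L c c-last = lastCell-growCells L (mapCells L ι c) fC _

  extend-isColimit : (L : Chain n) (c : Cells L X) (c-last : lastCell L c ≡ xC) →
                     IsChainColimit L X c → IsChainColimit (grow L) X′ (extendCells L c c-last)
  extend-isColimit L c c-last colim H e = v , v-factors , v-unique
    where
    sc : s X′ n fC ≡ lastCell L (mapCells L ι c)
    sc = trans s-f (sym (trans (lastCell-mapCells L ι c) (cong (fun ι n) c-last)))

    u : GMor X H
    u = proj₁ (colim H (shrinkCells L e))

    u-factors : Factors L c (shrinkCells L e) u
    u-factors = proj₁ (proj₂ (colim H (shrinkCells L e)))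

    φ : Cell H (suc n)
    φ = lastCell (grow L) e

    sφ : s H n φ ≡ fun u n xC
    sφ = sym (begin
      fun u n xC                             ≡⟨ cong (fun u n) (sym c-last) ⟩
      fun u n (lastCell L c)                 ≡⟨ Factors-last L c (shrinkCells L e) u u-factors ⟩
      lastCell L (shrinkCells L e)           ≡⟨ lastCell-shrinkCells L e ⟩
      s H n φ                                ∎)

    v : GMor X′ H
    v = extend u φ sφ

    v-factors : Factors (grow L) (extendCells L c c-last) e v
    v-factors = Factors-growCells⇐ L (mapCells L ι c) fC sc e v
      (Factors-mapCells⇐ L ι c (shrinkCells L e) v
        (Factors-cong L c (shrinkCells L e) u (v ∘ᴹ ι) (λ k c′ → sym (extend-ι u φ sφ k c′)) u-factors))
      (extend-f u φ sφ (suc n) (proj₂ fC) refl)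

    v-unique : (v′ : GMor X′ H) → Factors (grow L) (extendCells L c c-last) e v′ → ∀ k z → fun v k z ≡ fun v′ k z
    v-unique v′ f′ = extend-unique u φ sφ v′
      (λ k z → sym (proj₂ (proj₂ (colim H (shrinkCells L e))) (v′ ∘ᴹ ι)
         (Factors-mapCells⇒ L ι c (shrinkCells L e) v′ (Factors-growCells⇒ L (mapCells L ι c) fC sc e v′ f′)) k z))
      (trans (cong (fun v′ (suc n)) (sym (lastCell-growCells L (mapCells L ι c) fC sc)))
             (Factors-last (grow L) (extendCells L c c-last) e v′ f′))

-- ps-contexts are pasting schemes

-- The invariant along a derivation: G^Γ is the colimit of L, and the focus x is the iterated target
-- of the last cell of L.
record Presentation (Γ : Ctx) (x : Var) (A : Ty) {l : ℕ} (L : Chain l) : Set₁ where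
  field
    wf        : WellFormed Γ
    x∶A       : lookupVar Γ x ≡ just A
    cells     : Cells L (GSetOf Γ wf)
    isColimit : IsChainColimit L (GSetOf Γ wf) cells
    dimA≤l    : dim A ≤ l
    focus     : proj₁ (iterTgt (GSetOf Γ wf) (≤⇒≤′ dimA≤l) (lastCell L cells)) ≡ x

lookup-point : ∀ z v → (v ≡ z × lookupVar (∅ ▸ z ∶ ⋆) v ≡ just ⋆) ⊎ lookupVar (∅ ▸ z ∶ ⋆) v ≡ nothing
lookup-point z v with v ≟ z
... | yes e = inj₁ (e , refl)
... | no _  = inj₂ refl

module Point (z : Var) where

  Γ₀ : Ctx
  Γ₀ = ∅ ▸ z ∶ ⋆

  wf₀ : WellFormed Γ₀
  wf₀ v B a b eq with lookup-point z v
  ... | inj₁ (_ , h) with trans (sym h) eq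
  ...   | ()
  wf₀ v B a b eq | inj₂ h = ⊥-elim (nothing≢just (trans (sym h) eq))

  X₀ : GSet
  X₀ = GSetOf Γ₀ wf₀

  mem₀ : ∀ k v → T (mem (G^ Γ₀) k v) → k ≡ 0 × v ≡ z
  mem₀ k v v∈ with mem⇒declared Γ₀ k v v∈ | lookup-point z v
  ... | B , eq , refl | inj₁ (refl , h) = cong dim (just-injective (trans (sym eq) h)) , refl
  ... | B , eq , _    | inj₂ h          = ⊥-elim (nothing≢just (trans (sym h) eq))

  zC : Cell X₀ 0
  zC = z , declared⇒mem Γ₀ z ⋆ 0 (lookup-here ∅ z ⋆) refl

  isColimit₀ : IsChainColimit (base 0) X₀ zC
  isColimit₀ H e = u , subst-refl {H} _ e , unique
    where
    no-higher : ∀ k → Cell X₀ (suc k) → ⊥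
    no-higher k (v , v∈) with proj₁ (mem₀ (suc k) v v∈)
    ... | ()

    u : GMor X₀ H
    u = record
      { fun = λ k c → subst (Cell H) (sym (proj₁ (mem₀ k (proj₁ c) (proj₂ c)))) e
      ; fs  = λ k c → ⊥-elim (no-higher k c)
      ; ft  = λ k c → ⊥-elim (no-higher k c)
      }

    unique : (u′ : GMor X₀ H) → fun u′ 0 zC ≡ e → ∀ k c → fun u k c ≡ fun u′ k c
    unique u′ u′z k (v , v∈) = on-z k v v∈ (proj₁ (mem₀ k v v∈)) (proj₂ (mem₀ k v v∈))
      where
      on-z : ∀ k v v∈ (e₁ : k ≡ 0) (e₂ : v ≡ z) → subst (Cell H) (sym e₁) e ≡ fun u′ k (v , v∈)
      on-z .0 .z v∈ refl refl = trans (sym u′z) (cong (fun u′ 0) (cell-≡ {G^ Γ₀} {G^-isGlobular Γ₀ wf₀} refl))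

  presentation₀ : Presentation Γ₀ z ⋆ (base 0)
  presentation₀ = record
    { wf = wf₀ ; x∶A = lookup-here ∅ z ⋆ ; cells = zC ; isColimit = isColimit₀ ; dimA≤l = z≤n ; focus = refl }

module _ {Γ x A l} {L : Chain l} (P : Presentation Γ x A L) where
  open Presentation P
  private
    X : GSet
    X = GSetOf Γ wf

  presentation-degenerate : ∀ j → dim A ≡ j → (p : j ≤ l) → Presentation Γ x A (step L j j p ≤-refl)
  presentation-degenerate .(dim A) refl p = record
    { wf = wf ; x∶A = x∶A ; cells = degenerateCells L cells p ; isColimit = degenerate-isColimit L cells isColimit p
    ; dimA≤l = ≤-refl
    ; focus = trans (cong proj₁ (iter∂-refl X true (≤⇒≤′ ≤-refl) (iterTgt X (≤⇒≤′ p) (lastCell L cells))))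
                    (trans (cong (λ r → proj₁ (iterTgt X (≤⇒≤′ r) (lastCell L cells))) (≤-irrelevant p dimA≤l)) focus)
    }

  presentation-grow : dim A ≡ l → (y f : Var) (y∉ : y ∉FV Γ) (f∉ : f ∉FV Γ) (y≢f : y ≢ f) →
                      Presentation (Γ ▸ y ∶ A ▸ f ∶ Hom A x y) f (Hom A x y) (grow L)
  presentation-grow refl y f y∉ f∉ y≢f = record
    { wf = wf′ ; x∶A = lookup-f ; cells = extendCells L cells c-last ; isColimit = extend-isColimit L cells c-last isColimit
    ; dimA≤l = ≤-refl
    ; focus = cong proj₁ (trans (iter∂-refl X′ true (≤⇒≤′ ≤-refl) _) (lastCell-extendCells L cells c-last))
    }
    where
    open Extension Γ x A y f x∶A wf y∉ f∉ y≢f (dim A) refl hiding (X)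
    c-last : lastCell L cells ≡ xC
    c-last = cell-≡ {G^ Γ} {G^-isGlobular Γ wf} (trans (sym (cong proj₁ (iter∂-refl X true (≤⇒≤′ dimA≤l) _))) focus)

  presentation-drop : ∀ {B a b} → A ≡ Hom B a b → Presentation Γ b B L
  presentation-drop {B} {a} {b} refl = record
    { wf = wf ; x∶A = proj₂ (wf x B a b x∶A) ; cells = cells ; isColimit = isColimit ; dimA≤l = dimB≤l
    ; focus = begin
        proj₁ (iterTgt X (≤⇒≤′ dimB≤l) (lastCell L cells))
          ≡⟨ cong (λ r → proj₁ (iterTgt X r (lastCell L cells)))
                  (≤′-irrelevant (≤⇒≤′ dimB≤l) (<′⇒≤′ (≤⇒≤′ dimA≤l))) ⟩
        proj₁ (iterTgt X (<′⇒≤′ (≤⇒≤′ dimA≤l)) (lastCell L cells))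
          ≡⟨ cong proj₁ (iterTgt-last X (≤⇒≤′ dimA≤l) (lastCell L cells)) ⟩
        tgt (G^ Γ) (dim B) (proj₁ (iterTgt X (≤⇒≤′ dimA≤l) (lastCell L cells)))
          ≡⟨ cong (tgt (G^ Γ) (dim B)) focus ⟩
        tgt (G^ Γ) (dim B) x
          ≡⟨ tgt-declared Γ (dim B) x B a b x∶A ⟩
        b ∎
    }
    where
    dimB≤l : dim B ≤ l
    dimB≤l = ≤-trans (n≤1+n (dim B)) dimA≤l

presentation : ∀ {Γ x A} → Γ ⊢ps x ∶ A → Σ ℕ λ l → Σ (Chain l) (Presentation Γ x A)
presentation (ps-start z) = 0 , base 0 , Point.presentation₀ z
presentation {A = Hom A _ _} (ps-ext {y = y} {f = f} d y∉ f∉ y≢f) with presentation d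
... | l , L , P = _ , _ , presentation-grow (presentation-degenerate P (dim A) refl (Presentation.dimA≤l P)) refl y f y∉ f∉ y≢f
presentation (ps-drop d) with presentation d
... | l , L , P = l , L , presentation-drop P refl

⊢ps-declared : ∀ {Γ x A} → Γ ⊢ps x ∶ A → lookupVar Γ x ≡ just A
⊢ps-declared d = Presentation.x∶A (proj₂ (proj₂ (presentation d)))

⊢ps-wellFormed : ∀ {Γ x A} → Γ ⊢ps x ∶ A → WellFormed Γ
⊢ps-wellFormed d = Presentation.wf (proj₂ (proj₂ (presentation d)))

snocFun : ∀ {k} {S : Set} → (Fin k → S) → S → Fin (suc k) → S
snocFun {k} {S} g a m = by-view m (snocView m)
  where
  by-view : (m : Fin (suc k)) → SnocView m → S
  by-view .(inject₁ m) (inner m) = g m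
  by-view .(fromℕ _)   last      = a

snocFun-inject₁ : ∀ {k} {S : Set} (g : Fin k → S) a m → snocFun g a (inject₁ m) ≡ g m
snocFun-inject₁ g a m rewrite snocView-inject₁ m = refl

snocFun-fromℕ : ∀ {k} {S : Set} (g : Fin k → S) a → snocFun g a (fromℕ k) ≡ a
snocFun-fromℕ {k} g a rewrite snocView-fromℕ k = refl

mutual
  diagramOf : ∀ {l} → Chain l → Diagram
  diagramOf (base a) = record { len = 0 ; i = λ _ → a ; j = λ () ; jl = λ () ; jr = λ () }
  diagramOf (step L j′ i′ p q) = record
    { len = suc k ; i = snocFun (i d) i′ ; j = snocFun (j d) j′
    ; jl = λ m → jl′ m (snocView m) ; jr = λ m → jr′ m (snocView m) }
    where
    d : Diagram
    d = diagramOf L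
    k : ℕ
    k = len d
    jl′ : (m : Fin (suc k)) → SnocView m → snocFun (j d) j′ m ≤ snocFun (i d) i′ (inject₁ m)
    jl′ .(inject₁ m) (inner m) = subst₂ _≤_ (sym (snocFun-inject₁ (j d) j′ m)) (sym (snocFun-inject₁ (i d) i′ (inject₁ m))) (jl d m)
    jl′ .(fromℕ k)   last      = subst₂ _≤_ (sym (snocFun-fromℕ (j d) j′))
                                   (sym (trans (snocFun-inject₁ (i d) i′ (fromℕ k)) (diagramOf-last L))) p
    jr′ : (m : Fin (suc k)) → SnocView m → snocFun (j d) j′ m ≤ snocFun (i d) i′ (fsuc m)
    jr′ .(inject₁ m) (inner m) = subst₂ _≤_ (sym (snocFun-inject₁ (j d) j′ m)) (sym (snocFun-inject₁ (i d) i′ (fsuc m))) (jr d m)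
    jr′ .(fromℕ k)   last      = subst₂ _≤_ (sym (snocFun-fromℕ (j d) j′)) (sym (snocFun-fromℕ (i d) i′)) q

  diagramOf-last : ∀ {l} (L : Chain l) → i (diagramOf L) (fromℕ (len (diagramOf L))) ≡ l
  diagramOf-last (base a)           = refl
  diagramOf-last (step L j′ i′ p q) = snocFun-fromℕ (i (diagramOf L)) i′

subst-step : ∀ {l l′ j j′ i i′} (el : l ≡ l′) (ej : j ≡ j′) (ei : i ≡ i′) {R : Chain l} {R′ : Chain l′} →
             subst Chain el R ≡ R′ → ∀ p q p′ q′ → subst Chain ei (step R j i p q) ≡ step R′ j′ i′ p′ q′
subst-step refl refl refl refl p q p′ q′ = cong₂ (step _ _ _) (≤-irrelevant p p′) (≤-irrelevant q q′)

chainOf-cong : ∀ k i j jl jr i′ j′ jl′ jr′ (ei : ∀ m → i m ≡ i′ m) (ej : ∀ m → j m ≡ j′ m) →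
               subst Chain (ei (fromℕ k)) (chainOf k i j jl jr) ≡ chainOf k i′ j′ jl′ jr′
chainOf-cong zero    i j jl jr i′ j′ jl′ jr′ ei ej = subst-base (ei fzero)
  where
  subst-base : ∀ {a a′} (e : a ≡ a′) → subst Chain e (base a) ≡ base a′
  subst-base refl = refl
chainOf-cong (suc k) i j jl jr i′ j′ jl′ jr′ ei ej =
  subst-step (ei (inject₁ (fromℕ k))) (ej (fromℕ k)) (ei (fromℕ (suc k)))
    (chainOf-cong k _ _ _ _ _ _ (λ m → jl′ (inject₁ m)) (λ m → jr′ (inject₁ m)) (λ m → ei (inject₁ m)) (λ m → ej (inject₁ m)))
    _ _ _ _

toChain-diagramOf : ∀ {l} (L : Chain l) → subst Chain (diagramOf-last L) (toChain (diagramOf L)) ≡ L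
toChain-diagramOf (base a) = refl
toChain-diagramOf (step L j′ i′ p q) =
  subst-step (trans (snocFun-inject₁ (i d) i′ (fromℕ k)) (diagramOf-last L)) (snocFun-fromℕ (j d) j′) (snocFun-fromℕ (i d) i′)
    (trans (sym (subst-subst (snocFun-inject₁ (i d) i′ (fromℕ k))))
      (trans (cong (subst Chain (diagramOf-last L))
               (chainOf-cong k _ _ _ _ (i d) (j d) (jl d) (jr d) (snocFun-inject₁ (i d) i′) (snocFun-inject₁ (j d) j′)))
             (toChain-diagramOf L)))
    _ _ _ _
  where
  d : Diagram
  d = diagramOf L
  k : ℕ
  k = len d

subst-isChainColimit : ∀ {l l′} (e : l′ ≡ l) (L′ : Chain l′) (L : Chain l) → subst Chain e L′ ≡ L →
                       ∀ X (c : Cells L X) → IsChainColimit L X c → Σ (Cells L′ X) (IsChainColimit L′ X)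
subst-isChainColimit refl L′ .L′ refl X c colim = c , colim

ps⇒In𝒢 : (Γ : Ctx) → Γ ⊢ps → In𝒢 (G^ Γ)
ps⇒In𝒢 Γ (ps-done d) with presentation d
... | l , L , P = (G^-isGlobular Γ wf , diagramOf L , coconeOf (diagramOf L) c , chainColimit⇒colimit (diagramOf L) c colim) ,
                  G^-disjoint Γ
  where
  open Presentation P
  c,colim : Σ (Cells (toChain (diagramOf L)) (GSetOf Γ wf)) (IsChainColimit (toChain (diagramOf L)) (GSetOf Γ wf))
  c,colim = subst-isChainColimit (diagramOf-last L) (toChain (diagramOf L)) L (toChain-diagramOf L) (GSetOf Γ wf) cells isColimit
  c : Cells (toChain (diagramOf L)) (GSetOf Γ wf)
  c = proj₁ c,colim
  colim : IsChainColimit (toChain (diagramOf L)) (GSetOf Γ wf) c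
  colim = proj₂ c,colim

-- Every pasting scheme is presented by a ps-context

drop-to : ∀ {Γ x A l} {L : Chain l} → Γ ⊢ps x ∶ A → Presentation Γ x A L → ∀ j → j ≤ dim A →
          Σ Var λ z → Σ Ty λ B → (Γ ⊢ps z ∶ B) × Presentation Γ z B L × (dim B ≡ j)
drop-to {A = ⋆}       d P .0 z≤n = _ , ⋆ , d , P , refl
drop-to {A = Hom B a b} d P j j≤ with m≤n⇒m<n∨m≡n j≤
... | inj₂ refl       = _ , Hom B a b , d , P , refl
... | inj₁ (s≤s j≤′)  = drop-to (ps-drop d) (presentation-drop P refl) j j≤′

VarsBelow : Ctx → ℕ → Set
VarsBelow Γ N = ∀ v → v ∈FV Γ → v < N

VarsBelow-snoc : ∀ Γ x A N → lookupVar Γ x ≡ just A → VarsBelow Γ N →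
                 VarsBelow (Γ ▸ N ∶ A ▸ suc N ∶ Hom A x N) (suc (suc N))
VarsBelow-snoc Γ x A N x∶A below v v∈ = by-position v∈
  where
  old : ∀ {w} → w ∈FV Γ → w < suc (suc N)
  old w∈ = <-trans (below _ w∈) (<-trans (n<1+n N) (n<1+n (suc N)))
  N< : N < suc (suc N)
  N< = <-trans (n<1+n N) (n<1+n (suc N))
  by-position : v ∈FV (Γ ▸ N ∶ A ▸ suc N ∶ Hom A x N) → v < suc (suc N)
  by-position (inj₁ (inj₁ h))                  = old h
  by-position (inj₁ (inj₂ (inj₁ refl)))        = N<
  by-position (inj₁ (inj₂ (inj₂ h)))           = old (∈Ty⇒∈FV Γ x A v x∶A h)
  by-position (inj₂ (inj₁ refl))               = n<1+n (suc N)
  by-position (inj₂ (inj₂ (inj₁ h)))           = old (∈Ty⇒∈FV Γ x A v x∶A h)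
  by-position (inj₂ (inj₂ (inj₂ (inj₁ refl)))) = old (declared⇒∈FV Γ x A x∶A)
  by-position (inj₂ (inj₂ (inj₂ (inj₂ refl)))) = N<

VarsBelow⇒fresh : ∀ {Γ N} → VarsBelow Γ N → N ∉FV Γ
VarsBelow⇒fresh below h = <-irrefl refl (below _ h)

VarsBelow⇒fresh′ : ∀ {Γ N} → VarsBelow Γ N → suc N ∉FV Γ
VarsBelow⇒fresh′ {N = N} below h = <-irrefl refl (<-trans (n<1+n N) (below _ h))

-- A ps-context presented by L, using the variables 0, 1, 2, … in order.
record Canonical {l : ℕ} (L : Chain l) : Set₁ where
  field
    Γ      : Ctx
    x      : Var
    A      : Ty
    N      : ℕ
    ⊢x     : Γ ⊢ps x ∶ A
    pres   : Presentation Γ x A L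
    dimA   : dim A ≡ l
    below  : VarsBelow Γ N

canonical-grow : ∀ {l} {L : Chain l} → Canonical L → Canonical (grow L)
canonical-grow {l} {L} K = record
  { Γ     = Γ ▸ N ∶ A ▸ suc N ∶ Hom A x N
  ; x     = suc N
  ; A     = Hom A x N
  ; N     = suc (suc N)
  ; ⊢x    = ps-ext ⊢x (VarsBelow⇒fresh below) (VarsBelow⇒fresh′ below) N≢sucN
  ; pres  = presentation-grow pres dimA N (suc N) (VarsBelow⇒fresh below) (VarsBelow⇒fresh′ below) N≢sucN
  ; dimA  = cong suc dimA
  ; below = VarsBelow-snoc Γ x A N (Presentation.x∶A pres) below
  }
  where
  open Canonical K
  N≢sucN : N ≢ suc N
  N≢sucN e = <-irrefl e (n<1+n N)

canonical-base : ∀ a → Canonical (base a)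
canonical-base zero = record
  { Γ = ∅ ▸ 0 ∶ ⋆ ; x = 0 ; A = ⋆ ; N = 1 ; ⊢x = ps-start 0 ; pres = Point.presentation₀ 0 ; dimA = refl
  ; below = λ { v (inj₂ (inj₁ refl)) → s≤s z≤n ; v (inj₁ ()) ; v (inj₂ (inj₂ ())) } }
canonical-base (suc a) = canonical-grow (canonical-base a)

-- The new disk D_i is reached by dropping to dimension j and then growing i − j times.
canonical-step : ∀ {l} (L : Chain l) → Canonical L → ∀ j i (p : j ≤ l) (q : j ≤ i) → Canonical (step L j i p q)
canonical-step {l} L K j i p q =
  subst (λ r → Canonical (step L j i p r)) (≤-irrelevant (≤′⇒≤ (≤⇒≤′ q)) q) (grown (≤⇒≤′ q))
  where
  open Canonical K
  dropped : Σ Var λ z → Σ Ty λ B → (Γ ⊢ps z ∶ B) × Presentation Γ z B L × (dim B ≡ j)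
  dropped = drop-to ⊢x pres j (subst (j ≤_) (sym dimA) p)
  grown : ∀ {i} (r : j ≤′ i) → Canonical (step L j i p (≤′⇒≤ r))
  grown ≤′-refl with dropped
  ... | z , B , ⊢z , Pz , dimB = record
    { Γ = Γ ; x = z ; A = B ; N = N ; ⊢x = ⊢z ; pres = presentation-degenerate Pz j dimB p ; dimA = dimB ; below = below }
  grown (≤′-step r) = canonical-grow (grown r)

canonical : ∀ {l} (L : Chain l) → Canonical L
canonical (base a)         = canonical-base a
canonical (step L j i p q) = canonical-step L (canonical L) j i p q

colimit-unique : ∀ d {X Y} (cX : Cocone d X) (cY : Cocone d Y) → IsColimit d X cX → IsColimit d Y cY →
                 Σ (GMor X Y) λ u → Σ (GMor Y X) λ w → (∀ n x → fun w n (fun u n x) ≡ x) × (∀ n y → fun u n (fun w n y) ≡ y)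
colimit-unique d {X} {Y} cX cY colX colY = u , w , inverse colX colY , inverse colY colX
  where
  u : GMor X Y
  u = proj₁ (colX Y cY)
  w : GMor Y X
  w = proj₁ (colY X cX)
  inverse : ∀ {X Y} {cX : Cocone d X} {cY : Cocone d Y} (colX : IsColimit d X cX) (colY : IsColimit d Y cY) →
            ∀ n x → fun (proj₁ (colY X cX)) n (fun (proj₁ (colX Y cY)) n x) ≡ x
  inverse {X} {Y} {cX} {cY} colX colY n x =
    trans (sym (proj₂ (proj₂ (colX X cX)) (proj₁ (colY X cX) ∘ᴹ proj₁ (colX Y cY))
                 (λ m k z → trans (cong (fun (proj₁ (colY X cX)) k) (proj₁ (proj₂ (colX Y cY)) m k z))
                                  (proj₁ (proj₂ (colY X cX)) m k z)) n x))
          (proj₂ (proj₂ (colX X cX)) idᴹ (λ m k z → refl) n x)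

renameTy : (Var → Var) → Ty → Ty
renameTy ρ ⋆           = ⋆
renameTy ρ (Hom A a b) = Hom (renameTy ρ A) (ρ a) (ρ b)

renameCtx : (Var → Var) → Ctx → Ctx
renameCtx ρ ∅           = ∅
renameCtx ρ (Γ ▸ x ∶ A) = renameCtx ρ Γ ▸ ρ x ∶ renameTy ρ A

dim-renameTy : ∀ ρ A → dim (renameTy ρ A) ≡ dim A
dim-renameTy ρ ⋆           = refl
dim-renameTy ρ (Hom A a b) = cong suc (dim-renameTy ρ A)

∈Ty-renameTy : ∀ ρ A v′ → v′ ∈Ty renameTy ρ A → Σ Var λ v → v ∈Ty A × ρ v ≡ v′
∈Ty-renameTy ρ ⋆           v′ ()
∈Ty-renameTy ρ (Hom A a b) v′ (inj₁ h) with ∈Ty-renameTy ρ A v′ h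
... | v , h′ , e = v , inj₁ h′ , e
∈Ty-renameTy ρ (Hom A a b) v′ (inj₂ (inj₁ refl)) = a , inj₂ (inj₁ refl) , refl
∈Ty-renameTy ρ (Hom A a b) v′ (inj₂ (inj₂ refl)) = b , inj₂ (inj₂ refl) , refl

∈FV-renameCtx : ∀ ρ Γ v′ → v′ ∈FV renameCtx ρ Γ → Σ Var λ v → v ∈FV Γ × ρ v ≡ v′
∈FV-renameCtx ρ ∅           v′ ()
∈FV-renameCtx ρ (Γ ▸ x ∶ A) v′ (inj₁ h) with ∈FV-renameCtx ρ Γ v′ h
... | v , h′ , e = v , inj₁ h′ , e
∈FV-renameCtx ρ (Γ ▸ x ∶ A) v′ (inj₂ (inj₁ refl)) = x , inj₂ (inj₁ refl) , refl
∈FV-renameCtx ρ (Γ ▸ x ∶ A) v′ (inj₂ (inj₂ h)) with ∈Ty-renameTy ρ A v′ h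
... | v , h′ , e = v , inj₂ (inj₂ h′) , e

InjectiveOn : Ctx → (Var → Var) → Set
InjectiveOn Γ ρ = ∀ v v′ → v ∈FV Γ → v′ ∈FV Γ → ρ v ≡ ρ v′ → v ≡ v′

rename-fresh : ∀ ρ Γ {w} → InjectiveOn Γ ρ → w ∈FV Γ → ∀ {Δ} → (∀ {v} → v ∈FV Δ → v ∈FV Γ) → w ∉FV Δ →
               ρ w ∉FV renameCtx ρ Δ
rename-fresh ρ Γ inj w∈ Δ⊆Γ w∉ h with ∈FV-renameCtx ρ _ (ρ _) h
... | v , v∈ , ρv≡ρw = w∉ (subst (_∈FV _) (inj _ _ (Δ⊆Γ v∈) w∈ ρv≡ρw) v∈)

rename-⊢ps : ∀ ρ {Γ x A} → Γ ⊢ps x ∶ A → InjectiveOn Γ ρ → renameCtx ρ Γ ⊢ps ρ x ∶ renameTy ρ A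
rename-⊢ps ρ (ps-start x) inj = ps-start (ρ x)
rename-⊢ps ρ (ps-ext {Γ} {x} {A} {y} {f} d y∉ f∉ y≢f) inj =
  ps-ext (rename-⊢ps ρ d (λ v v′ h h′ → inj v v′ (inj₁ (inj₁ h)) (inj₁ (inj₁ h′))))
    (rename-fresh ρ _ inj (inj₁ (inj₂ (inj₁ refl))) (λ h → inj₁ (inj₁ h)) y∉)
    (rename-fresh ρ _ inj (inj₂ (inj₁ refl)) (λ h → inj₁ (inj₁ h)) f∉)
    (λ e → y≢f (inj y f (inj₁ (inj₂ (inj₁ refl))) (inj₂ (inj₁ refl)) e))
rename-⊢ps ρ (ps-drop d) inj = ps-drop (rename-⊢ps ρ d inj)

⊢ps∶⇒⊢ps : ∀ {Γ x A} → Γ ⊢ps x ∶ A → Γ ⊢ps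
⊢ps∶⇒⊢ps {A = ⋆}         d = ps-done d
⊢ps∶⇒⊢ps {A = Hom A a b} d = ⊢ps∶⇒⊢ps (ps-drop d)

lookup-rename : ∀ ρ Γ → InjectiveOn Γ ρ → ∀ v B → lookupVar Γ v ≡ just B →
                lookupVar (renameCtx ρ Γ) (ρ v) ≡ just (renameTy ρ B)
lookup-rename ρ ∅           inj v B ()
lookup-rename ρ (Γ ▸ x ∶ A) inj v B eq with v ≟ x
... | yes refl = trans (lookup-here (renameCtx ρ Γ) (ρ v) (renameTy ρ A)) (cong (λ C → just (renameTy ρ C)) (just-injective eq))
... | no v≢x   =
  trans (lookup-there (renameCtx ρ Γ) (ρ v) (ρ x) (renameTy ρ A)
          (λ e → v≢x (inj v x (declared⇒∈FV (Γ ▸ x ∶ A) v B (trans (lookup-there Γ v x A v≢x) eq)) (inj₂ (inj₁ refl)) e)))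
        (lookup-rename ρ Γ (λ v v′ h h′ → inj v v′ (inj₁ h) (inj₁ h′)) v B eq)

lookup-rename⁻¹ : ∀ ρ Γ v′ B′ → lookupVar (renameCtx ρ Γ) v′ ≡ just B′ →
                  Σ Var λ v → Σ Ty λ B → lookupVar Γ v ≡ just B × ρ v ≡ v′ × B′ ≡ renameTy ρ B
lookup-rename⁻¹ ρ ∅           v′ B′ ()
lookup-rename⁻¹ ρ (Γ ▸ x ∶ A) v′ B′ eq with v′ ≟ ρ x
... | yes refl = x , A , lookup-here Γ x A , refl , sym (just-injective eq)
... | no v′≢ρx with lookup-rename⁻¹ ρ Γ v′ B′ eq
...   | v , B , v∶B , ρv≡v′ , B′≡ =
  v , B , trans (lookup-there Γ v x A (λ v≡x → v′≢ρx (trans (sym ρv≡v′) (cong ρ v≡x)))) v∶B , ρv≡v′ , B′≡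

∈FV⇒declared : ∀ {Γ x A} → Γ ⊢ps x ∶ A → ∀ v → v ∈FV Γ → Σ Ty λ B → lookupVar Γ v ≡ just B
∈FV⇒declared (ps-start x) v (inj₂ (inj₁ refl)) = ⋆ , lookup-here ∅ v ⋆
∈FV⇒declared (ps-drop d)  v h                  = ∈FV⇒declared d v h
∈FV⇒declared (ps-ext {Γ} {x} {A} {y} {f} d y∉ f∉ y≢f) v h = by-position h
  where
  open Snoc Γ x A y f (⊢ps-declared d) y∉ f∉ y≢f
  declared-in-Γ : v ∈FV Γ → Σ Ty λ B → lookupVar Γ′ v ≡ just B
  declared-in-Γ h′ with ∈FV⇒declared d v h′
  ... | B , eq = B , Γ⊑Γ′ v B eq
  by-position : v ∈FV Γ′ → Σ Ty λ B → lookupVar Γ′ v ≡ just B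
  by-position (inj₁ (inj₁ h′))                  = declared-in-Γ h′
  by-position (inj₁ (inj₂ (inj₁ refl)))         = A , lookup-y
  by-position (inj₁ (inj₂ (inj₂ h′)))           = declared-in-Γ (∈Ty⇒∈FV Γ x A v (⊢ps-declared d) h′)
  by-position (inj₂ (inj₁ refl))                = Hom A x y , lookup-f
  by-position (inj₂ (inj₂ (inj₁ h′)))           = declared-in-Γ (∈Ty⇒∈FV Γ x A v (⊢ps-declared d) h′)
  by-position (inj₂ (inj₂ (inj₂ (inj₁ refl))))  = declared-in-Γ (declared⇒∈FV Γ x A (⊢ps-declared d))
  by-position (inj₂ (inj₂ (inj₂ (inj₂ refl))))  = A , lookup-y

T-injective : ∀ {a b : Bool} → (T a → T b) → (T b → T a) → a ≡ b
T-injective {false} {false} _ _ = refl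
T-injective {false} {true}  _ g = ⊥-elim (g _)
T-injective {true}  {false} f _ = ⊥-elim (f _)
T-injective {true}  {true}  _ _ = refl

module Transport (G : VGSet) (G-glob : IsGlobular G) (G-disj : Disjoint G)
                 {Γ : Ctx} {x : Var} {A : Ty} (⊢x : Γ ⊢ps x ∶ A) (wf : WellFormed Γ)
                 (u : GMor (GSetOf Γ wf) (toGSet G G-glob)) (w : GMor (toGSet G G-glob) (GSetOf Γ wf))
                 (wu : ∀ n c → fun w n (fun u n c) ≡ c) (uw : ∀ n c → fun u n (fun w n c) ≡ c) where

  ρ-by : (v : Var) (m : Maybe Ty) → lookupVar Γ v ≡ m → Var
  ρ-by v (just B) eq = proj₁ (fun u (dim B) (v , declared⇒mem Γ v B (dim B) eq refl))
  ρ-by v nothing  _  = v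

  ρ : Var → Var
  ρ v = ρ-by v (lookupVar Γ v) refl

  ρ-cell : ∀ n v (v∈ : T (mem (G^ Γ) n v)) → ρ v ≡ proj₁ (fun u n (v , v∈))
  ρ-cell n v v∈ with mem⇒declared Γ n v v∈
  ... | B , eq , refl = by-lookup (lookupVar Γ v) refl eq
    where
    by-lookup : (m : Maybe Ty) (e : lookupVar Γ v ≡ m) → m ≡ just B → ρ-by v m e ≡ proj₁ (fun u (dim B) (v , v∈))
    by-lookup (just .B) e refl = cong (λ c → proj₁ (fun u (dim B) c)) (cell-≡ {G^ Γ} {G^-isGlobular Γ wf} refl)

  ρ-mem : ∀ n v (v∈ : T (mem (G^ Γ) n v)) → T (mem G n (ρ v))
  ρ-mem n v v∈ = subst (λ z → T (mem G n z)) (sym (ρ-cell n v v∈)) (proj₂ (fun u n (v , v∈)))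

  -- Disjointness of G makes cells of different dimensions have different names.
  ρ-injective : InjectiveOn Γ ρ
  ρ-injective v v′ v∈ v′∈ ρv≡ρv′ with ∈FV⇒declared ⊢x v v∈ | ∈FV⇒declared ⊢x v′ v′∈
  ... | B , v∶B | B′ , v′∶B′ =
    cells-injective (G-disj (dim B) (dim B′) (ρ v) (ρ-mem (dim B) v v∈B)
                      (subst (λ z → T (mem G (dim B′) z)) (sym ρv≡ρv′) (ρ-mem (dim B′) v′ v′∈B′)))
      (v , v∈B) (v′ , v′∈B′) (trans (sym (ρ-cell (dim B) v v∈B)) (trans ρv≡ρv′ (ρ-cell (dim B′) v′ v′∈B′)))
    where
    v∈B : T (mem (G^ Γ) (dim B) v)
    v∈B = declared⇒mem Γ v B (dim B) v∶B refl
    v′∈B′ : T (mem (G^ Γ) (dim B′) v′)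
    v′∈B′ = declared⇒mem Γ v′ B′ (dim B′) v′∶B′ refl
    cells-injective : ∀ {n n′} → n ≡ n′ → (c : Cell (GSetOf Γ wf) n) (c′ : Cell (GSetOf Γ wf) n′) →
                      proj₁ (fun u n c) ≡ proj₁ (fun u n′ c′) → proj₁ c ≡ proj₁ c′
    cells-injective {n} refl c c′ e =
      cong proj₁ (trans (sym (wu n c)) (trans (cong (fun w n) (cell-≡ {G} {G-glob} e)) (wu n c′)))

  Γρ : Ctx
  Γρ = renameCtx ρ Γ

  ⊢Γρ : Γρ ⊢ps
  ⊢Γρ = ⊢ps∶⇒⊢ps (rename-⊢ps ρ ⊢x ρ-injective)

  mem-Γρ : ∀ n v′ → mem (G^ Γρ) n v′ ≡ mem G n v′
  mem-Γρ n v′ = T-injective to from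
    where
    to : T (mem (G^ Γρ) n v′) → T (mem G n v′)
    to v′∈ with mem⇒declared Γρ n v′ v′∈
    ... | B′ , eq , dimB′ with lookup-rename⁻¹ ρ Γ v′ B′ eq
    ...   | v , B , v∶B , refl , refl = ρ-mem n v (declared⇒mem Γ v B n v∶B (trans (sym (dim-renameTy ρ B)) dimB′))
    from : T (mem G n v′) → T (mem (G^ Γρ) n v′)
    from v′∈ with fun w n (v′ , v′∈) in ew
    ... | v , v∈ with mem⇒declared Γ n v v∈
    ...   | B , v∶B , dimB =
      subst (λ z → T (mem (G^ Γρ) n z)) ρv≡v′
            (declared⇒mem Γρ (ρ v) (renameTy ρ B) n (lookup-rename ρ Γ ρ-injective v B v∶B) (trans (dim-renameTy ρ B) dimB))
      where
      ρv≡v′ : ρ v ≡ v′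
      ρv≡v′ = trans (ρ-cell n v v∈) (cong proj₁ (trans (cong (fun u n) (sym ew)) (uw n (v′ , v′∈))))

  ρ-∂ : ∀ b n v (v∈ : T (mem (G^ Γ) (suc n) v)) →
        ρ (proj₁ (∂ (GSetOf Γ wf) b n (v , v∈))) ≡ proj₁ (∂ (toGSet G G-glob) b n (ρ v , ρ-mem (suc n) v v∈))
  ρ-∂ b n v v∈ = begin
    ρ (proj₁ (∂ X b n (v , v∈)))                 ≡⟨ ρ-cell n _ (proj₂ (∂ X b n (v , v∈))) ⟩
    proj₁ (fun u n (∂ X b n (v , v∈)))           ≡⟨ cong proj₁ (∂-natural u b n (v , v∈)) ⟩
    proj₁ (∂ Y b n (fun u (suc n) (v , v∈)))
      ≡⟨ cong (λ c → proj₁ (∂ Y b n c)) (cell-≡ {G} {G-glob} (sym (ρ-cell (suc n) v v∈))) ⟩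
    proj₁ (∂ Y b n (ρ v , ρ-mem (suc n) v v∈))   ∎
    where
    X Y : GSet
    X = GSetOf Γ wf
    Y = toGSet G G-glob

  bd-Γρ : ∀ n v′ → T (mem (G^ Γρ) (suc n) v′) → src (G^ Γρ) n v′ ≡ src G n v′ × tgt (G^ Γρ) n v′ ≡ tgt G n v′
  bd-Γρ n v′ v′∈ with mem⇒declared Γρ (suc n) v′ v′∈
  ... | B′ , eq , dimB′ with lookup-rename⁻¹ ρ Γ v′ B′ eq
  ...   | v , Hom C a b , v∶B , refl , refl =
    trans (src-declared Γρ n (ρ v) _ (ρ a) (ρ b) eq) (trans (cong ρ (sym (src-declared Γ n v C a b v∶B))) (ρ-∂ false n v v∈)) ,
    trans (tgt-declared Γρ n (ρ v) _ (ρ a) (ρ b) eq) (trans (cong ρ (sym (tgt-declared Γ n v C a b v∶B))) (ρ-∂ true n v v∈))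
    where
    v∈ : T (mem (G^ Γ) (suc n) v)
    v∈ = declared⇒mem Γ v (Hom C a b) (suc n) v∶B (trans (sym (dim-renameTy ρ (Hom C a b))) dimB′)

  G^Γρ≡G : SameVG (G^ Γρ) G
  G^Γρ≡G = mem-Γρ , bd-Γρ

In𝒢⇒ps : (G : VGSet) → In𝒢 G → Σ Ctx (λ Γ → Γ ⊢ps × SameVG (G^ Γ) G)
In𝒢⇒ps G ((G-glob , d , cG , colG) , G-disj) = Γρ , ⊢Γρ , G^Γρ≡G
  where
  K : Canonical (toChain d)
  K = canonical (toChain d)
  open Canonical K using (Γ; ⊢x; pres)
  open Presentation pres using (wf; cells; isColimit)
  iso : Σ (GMor (GSetOf Γ wf) (toGSet G G-glob)) λ u → Σ (GMor (toGSet G G-glob) (GSetOf Γ wf)) λ w →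
          (∀ n c → fun w n (fun u n c) ≡ c) × (∀ n c → fun u n (fun w n c) ≡ c)
  iso = colimit-unique d (coconeOf d cells) cG (chainColimit⇒colimit d cells isColimit) colG
  open Transport G G-glob G-disj ⊢x wf (proj₁ iso) (proj₁ (proj₂ iso)) (proj₁ (proj₂ (proj₂ iso))) (proj₂ (proj₂ (proj₂ iso)))

-- A ps-context is determined by its globular set

-- spine F f k is the k-dimensional iterated target of f : F (for k ≤ dim F).
spine : Ty → Var → ℕ → Var
spine ⋆           f k = f
spine (Hom B a b) f k with k ≟ suc (dim B)
... | yes _ = f
... | no _  = spine B b k

spine-top′ : ∀ B a b f k → k ≡ suc (dim B) → spine (Hom B a b) f k ≡ f
spine-top′ B a b f k e with k ≟ suc (dim B)
... | yes _  = refl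
... | no k≢  = ⊥-elim (k≢ e)

spine-tgt : ∀ B a b f k → k ≢ suc (dim B) → spine (Hom B a b) f k ≡ spine B b k
spine-tgt B a b f k k≢ with k ≟ suc (dim B)
... | yes e = ⊥-elim (k≢ e)
... | no _  = refl

spine-top : ∀ F f → spine F f (dim F) ≡ f
spine-top ⋆           f = refl
spine-top (Hom B a b) f = spine-top′ B a b f _ refl

≤⇒≢suc : ∀ {k n} → k ≤ n → k ≢ suc n
≤⇒≢suc k≤n refl = 1+n≰n k≤n

spine-below : ∀ B a b f k → k ≤ dim B → spine (Hom B a b) f k ≡ spine B b k
spine-below B a b f k k≤ = spine-tgt B a b f k (≤⇒≢suc k≤)

spine-base-irrelevant : ∀ F v v′ k → k < dim F → spine F v k ≡ spine F v′ k
spine-base-irrelevant (Hom B a b) v v′ k (s≤s k≤) = trans (spine-below B a b v k k≤) (sym (spine-below B a b v′ k k≤))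

spine-declared : ∀ Γ → WellFormed Γ → ∀ F f → lookupVar Γ f ≡ just F → ∀ k → k ≤ dim F →
                 Σ Ty λ D → lookupVar Γ (spine F f k) ≡ just D × dim D ≡ k
spine-declared Γ wf ⋆           f f∶F .0 z≤n = ⋆ , f∶F , refl
spine-declared Γ wf (Hom B a b) f f∶F k k≤ with m≤n⇒m<n∨m≡n k≤
... | inj₂ refl     = Hom B a b , trans (cong (lookupVar Γ) (spine-top′ B a b f _ refl)) f∶F , refl
... | inj₁ (s≤s k≤′) = subst (λ z → Σ Ty λ D → lookupVar Γ z ≡ just D × dim D ≡ k) (sym (spine-below B a b f k k≤′))
                             (spine-declared Γ wf B b (proj₂ (wf f B a b f∶F)) k k≤′)

spine-declared-Hom : ∀ Γ → WellFormed Γ → ∀ F f → lookupVar Γ f ≡ just F → ∀ k → suc k ≤ dim F →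
                     Σ Ty λ D → Σ Var λ a → lookupVar Γ (spine F f (suc k)) ≡ just (Hom D a (spine F f k))
spine-declared-Hom Γ wf (Hom B a b) f f∶F k k< with m≤n⇒m<n∨m≡n k<
... | inj₂ refl =
  B , a , trans (cong (lookupVar Γ) (spine-top′ B a b f _ refl))
                (trans f∶F (cong (λ z → just (Hom B a z)) (sym (trans (spine-below B a b f (dim B) ≤-refl) (spine-top B b)))))
... | inj₁ (s≤s k<′) with spine-declared-Hom Γ wf B b (proj₂ (wf f B a b f∶F)) k k<′
...   | D , a′ , eq = D , a′ ,
  trans (cong (lookupVar Γ) (spine-below B a b f (suc k) k<′))
        (trans eq (cong (λ z → just (Hom D a′ z)) (sym (spine-below B a b f k (≤-trans (n≤1+n k) k<′)))))

IsSrc : Ctx → Var → Set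
IsSrc Γ v = Σ Var λ w → Σ Ty λ B → Σ Var λ b → lookupVar Γ w ≡ just (Hom B v b)

IsTgt : Ctx → Var → Set
IsTgt Γ v = Σ Var λ w → Σ Ty λ B → Σ Var λ a → lookupVar Γ w ≡ just (Hom B a v)

-- The invariants of a derivation Γ ⊢ps x ∶ A: no cell on the spine of x is a source, and a cell that is
-- not a source is determined by its target (by its dimension, for points).
SpineNonSource : Ctx → Var → Ty → Set
SpineNonSource Γ x A = ∀ k → k ≤ dim A → ¬ IsSrc Γ (spine A x k)

NonSourceByTarget : Ctx → Set
NonSourceByTarget Γ = ∀ w w′ B B′ a a′ b → lookupVar Γ w ≡ just (Hom B a b) → lookupVar Γ w′ ≡ just (Hom B′ a′ b) →
                      ¬ IsSrc Γ w → ¬ IsSrc Γ w′ → w ≡ w′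

NonSourcePoint : Ctx → Set
NonSourcePoint Γ = ∀ w w′ → lookupVar Γ w ≡ just ⋆ → lookupVar Γ w′ ≡ just ⋆ →
                   ¬ IsSrc Γ w → ¬ IsSrc Γ w′ → w ≡ w′

Hom≢⋆ : ∀ {B a b} → just (Hom B a b) ≢ just ⋆
Hom≢⋆ ()

module SnocSources (Γ : Ctx) (x : Var) (A : Ty) (y f : Var) (x∶A : lookupVar Γ x ≡ just A) (wf : WellFormed Γ)
                   (y∉ : y ∉FV Γ) (f∉ : f ∉FV Γ) (y≢f : y ≢ f) where
  open Snoc Γ x A y f x∶A y∉ f∉ y≢f

  fresh∉Ty : ∀ z → z ∉FV Γ → ∀ w C → lookupVar Γ w ≡ just C → ¬ (z ∈Ty C)
  fresh∉Ty z z∉ w C eq h = z∉ (∈Ty⇒∈FV Γ w C z eq h)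

  IsSrc-Γ′ : ∀ v → IsSrc Γ′ v → IsSrc Γ v ⊎ v ≡ x
  IsSrc-Γ′ v (w , B , b , eq) with kind w
  ... | is-f with trans (sym lookup-f) eq
  ...   | refl = inj₂ refl
  IsSrc-Γ′ v (w , B , b , eq) | is-y        = inj₁ (x , B , b , trans x∶A (trans (sym lookup-y) eq))
  IsSrc-Γ′ v (w , B , b , eq) | old w≢y w≢f = inj₁ (w , B , b , lookup-old′ w≢y w≢f eq)

  ¬IsSrc-Γ : ∀ v → ¬ IsSrc Γ′ v → ¬ IsSrc Γ v
  ¬IsSrc-Γ v ¬src (w , B , b , eq) = ¬src (w , B , b , Γ⊑Γ′ w _ eq)

  x-IsSrc : IsSrc Γ′ x
  x-IsSrc = f , A , y , lookup-f

  ¬IsSrc-fresh : ∀ z → z ∉FV Γ → z ≢ x → ¬ IsSrc Γ′ z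
  ¬IsSrc-fresh z z∉ z≢x (w , B , b , eq) with IsSrc-Γ′ z (w , B , b , eq)
  ... | inj₁ (w′ , B′ , b′ , eq′) = fresh∉Ty z z∉ w′ (Hom B′ z b′) eq′ (inj₂ (inj₁ refl))
  ... | inj₂ z≡x                 = z≢x z≡x

  ¬IsTgt-f : ¬ IsTgt Γ′ f
  ¬IsTgt-f (w , B , a , eq) with kind w
  ... | is-f with trans (sym lookup-f) eq
  ...   | refl = y≢f refl
  ¬IsTgt-f (w , B , a , eq) | is-y with trans (sym lookup-y) eq
  ...   | refl = fresh∉Ty f f∉ x (Hom B a f) x∶A (inj₂ (inj₂ refl))
  ¬IsTgt-f (w , B , a , eq) | old w≢y w≢f = fresh∉Ty f f∉ w (Hom B a f) (lookup-old′ w≢y w≢f eq) (inj₂ (inj₂ refl))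

  ¬IsSrc-Γ′ : ∀ v → ¬ IsSrc Γ v → v ≢ x → ¬ IsSrc Γ′ v
  ¬IsSrc-Γ′ v ¬src v≢x h with IsSrc-Γ′ v h
  ... | inj₁ h′  = ¬src h′
  ... | inj₂ v≡x = v≢x v≡x

  spineNonSource : SpineNonSource Γ x A → SpineNonSource Γ′ f (Hom A x y)
  spineNonSource h k k≤ with m≤n⇒m<n∨m≡n k≤
  ... | inj₂ refl = subst (λ z → ¬ IsSrc Γ′ z) (sym (spine-top (Hom A x y) f)) (¬IsSrc-fresh f f∉ (x≢f ∘ sym))
  ... | inj₁ (s≤s k≤′) with m≤n⇒m<n∨m≡n k≤′
  ...   | inj₂ refl =
    subst (λ z → ¬ IsSrc Γ′ z) (sym (trans (spine-below A x y f (dim A) ≤-refl) (spine-top A y))) (¬IsSrc-fresh y y∉ (x≢y ∘ sym))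
  ...   | inj₁ k< =
    subst (λ z → ¬ IsSrc Γ′ z) (sym (trans (spine-below A x y f k k≤′) (spine-base-irrelevant A y x k k<)))
          (¬IsSrc-Γ′ (spine A x k) (h k k≤′) spine≢x)
    where
    spine≢x : spine A x k ≢ x
    spine≢x e with spine-declared Γ wf A x x∶A k k≤′
    ... | D , D-decl , dimD =
      <-irrefl (trans (sym dimD) (cong dim (just-injective (trans (sym D-decl) (trans (cong (lookupVar Γ) e) x∶A))))) k<

  x-non-source : SpineNonSource Γ x A → ¬ IsSrc Γ x
  x-non-source h = subst (λ z → ¬ IsSrc Γ z) (spine-top A x) (h (dim A) ≤-refl)

  -- Only x becomes a source in Γ′, and x was not one in Γ since it is the focus.
  nonSourceByTarget : SpineNonSource Γ x A → NonSourceByTarget Γ → NonSourceByTarget Γ′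
  nonSourceByTarget h₁ h₂ w w′ B B′ a a′ b eq eq′ ¬w ¬w′ with kind w | kind w′
  ... | is-f | is-f = refl
  ... | is-f | is-y with trans (sym lookup-f) eq | trans (sym lookup-y) eq′
  ...   | refl | refl = ⊥-elim (fresh∉Ty y y∉ x (Hom B′ a′ y) x∶A (inj₂ (inj₂ refl)))
  nonSourceByTarget h₁ h₂ w w′ B B′ a a′ b eq eq′ ¬w ¬w′ | is-f | old w′≢y w′≢f with trans (sym lookup-f) eq
  ...   | refl = ⊥-elim (fresh∉Ty y y∉ w′ (Hom B′ a′ y) (lookup-old′ w′≢y w′≢f eq′) (inj₂ (inj₂ refl)))
  nonSourceByTarget h₁ h₂ w w′ B B′ a a′ b eq eq′ ¬w ¬w′ | is-y | is-f with trans (sym lookup-f) eq′ | trans (sym lookup-y) eq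
  ...   | refl | refl = ⊥-elim (fresh∉Ty y y∉ x (Hom B a y) x∶A (inj₂ (inj₂ refl)))
  nonSourceByTarget h₁ h₂ w w′ B B′ a a′ b eq eq′ ¬w ¬w′ | is-y | is-y = refl
  nonSourceByTarget h₁ h₂ w w′ B B′ a a′ b eq eq′ ¬w ¬w′ | is-y | old w′≢y w′≢f with trans (sym lookup-y) eq
  ...   | refl = ⊥-elim (¬w′ (subst (IsSrc Γ′)
                   (h₂ x w′ B B′ a a′ b x∶A (lookup-old′ w′≢y w′≢f eq′) (x-non-source h₁) (¬IsSrc-Γ w′ ¬w′)) x-IsSrc))
  nonSourceByTarget h₁ h₂ w w′ B B′ a a′ b eq eq′ ¬w ¬w′ | old w≢y w≢f | is-f with trans (sym lookup-f) eq′
  ...   | refl = ⊥-elim (fresh∉Ty y y∉ w (Hom B a y) (lookup-old′ w≢y w≢f eq) (inj₂ (inj₂ refl)))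
  nonSourceByTarget h₁ h₂ w w′ B B′ a a′ b eq eq′ ¬w ¬w′ | old w≢y w≢f | is-y with trans (sym lookup-y) eq′
  ...   | refl = ⊥-elim (¬w (subst (IsSrc Γ′)
                   (h₂ x w B′ B a′ a b x∶A (lookup-old′ w≢y w≢f eq) (x-non-source h₁) (¬IsSrc-Γ w ¬w)) x-IsSrc))
  nonSourceByTarget h₁ h₂ w w′ B B′ a a′ b eq eq′ ¬w ¬w′ | old w≢y w≢f | old w′≢y w′≢f =
    h₂ w w′ B B′ a a′ b (lookup-old′ w≢y w≢f eq) (lookup-old′ w′≢y w′≢f eq′) (¬IsSrc-Γ w ¬w) (¬IsSrc-Γ w′ ¬w′)

  nonSourcePoint : SpineNonSource Γ x A → NonSourcePoint Γ → NonSourcePoint Γ′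
  nonSourcePoint h₁ h₀ w w′ eq eq′ ¬w ¬w′ with kind w | kind w′
  ... | is-f | _    = ⊥-elim (Hom≢⋆ (trans (sym lookup-f) eq))
  ... | is-y | is-f = ⊥-elim (Hom≢⋆ (trans (sym lookup-f) eq′))
  ... | old _ _ | is-f = ⊥-elim (Hom≢⋆ (trans (sym lookup-f) eq′))
  ... | is-y | is-y = refl
  ... | is-y | old w′≢y w′≢f =
    ⊥-elim (¬w′ (subst (IsSrc Γ′) (h₀ x w′ (trans x∶A (trans (sym lookup-y) eq)) (lookup-old′ w′≢y w′≢f eq′)
                                      (x-non-source h₁) (¬IsSrc-Γ w′ ¬w′)) x-IsSrc))
  ... | old w≢y w≢f | is-y =
    ⊥-elim (¬w (subst (IsSrc Γ′) (h₀ x w (trans x∶A (trans (sym lookup-y) eq′)) (lookup-old′ w≢y w≢f eq)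
                                     (x-non-source h₁) (¬IsSrc-Γ w ¬w)) x-IsSrc))
  ... | old w≢y w≢f | old w′≢y w′≢f =
    h₀ w w′ (lookup-old′ w≢y w≢f eq) (lookup-old′ w′≢y w′≢f eq′) (¬IsSrc-Γ w ¬w) (¬IsSrc-Γ w′ ¬w′)

⊢ps-invariants : ∀ {Γ x A} → Γ ⊢ps x ∶ A → SpineNonSource Γ x A × NonSourceByTarget Γ × NonSourcePoint Γ
⊢ps-invariants (ps-start z) = (λ k _ → no-src _) , (λ w w′ B B′ a a′ b eq _ _ _ → ⊥-elim (no-src a (w , B , b , eq))) , points
  where
  no-src : ∀ v → ¬ IsSrc (∅ ▸ z ∶ ⋆) v
  no-src v (w , B , b , eq) with lookup-point z w
  ... | inj₁ (_ , h) = Hom≢⋆ (trans (sym eq) h)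
  ... | inj₂ h       = nothing≢just (trans (sym h) eq)
  points : NonSourcePoint (∅ ▸ z ∶ ⋆)
  points w w′ eq eq′ _ _ with lookup-point z w | lookup-point z w′
  ... | inj₁ (w≡z , _) | inj₁ (w′≡z , _) = trans w≡z (sym w′≡z)
  ... | inj₂ h         | _               = ⊥-elim (nothing≢just (trans (sym h) eq))
  ... | _              | inj₂ h          = ⊥-elim (nothing≢just (trans (sym h) eq′))
⊢ps-invariants (ps-ext {Γ} {x} {A} {y} {f} d y∉ f∉ y≢f) with ⊢ps-invariants d
... | h₁ , h₂ , h₀ = spineNonSource h₁ , nonSourceByTarget h₁ h₂ , nonSourcePoint h₁ h₀
  where open SnocSources Γ x A y f (⊢ps-declared d) (⊢ps-wellFormed d) y∉ f∉ y≢f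
⊢ps-invariants (ps-drop {Γ} {f} {A} {x} {y} d) with ⊢ps-invariants d
... | h₁ , h₂ , h₀ =
  (λ k k≤ → subst (λ z → ¬ IsSrc Γ z) (spine-below A x y f k k≤) (h₁ k (≤-trans k≤ (n≤1+n _)))) , h₂ , h₀

module Maximal (Γ : Ctx) (wf : WellFormed Γ) (h₂ : NonSourceByTarget Γ) (h₀ : NonSourcePoint Γ) where

  on-spine : ∀ C g → lookupVar Γ g ≡ just C → SpineNonSource Γ g C → ∀ F f → lookupVar Γ f ≡ just F → SpineNonSource Γ f F →
             dim C ≤ dim F → g ≡ spine F f (dim C)
  on-spine ⋆ g g∶C g-ns F f f∶F f-ns _ with spine-declared Γ wf F f f∶F 0 z≤n
  ... | D , D-decl , dimD = h₀ g (spine F f 0) g∶C (trans D-decl (cong just (dim≡0 D dimD))) (g-ns 0 z≤n) (f-ns 0 z≤n)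
    where
    dim≡0 : ∀ D → dim D ≡ 0 → D ≡ ⋆
    dim≡0 ⋆ _ = refl
  on-spine (Hom B a b) g g∶C g-ns F f f∶F f-ns C≤F with spine-declared-Hom Γ wf F f f∶F (dim B) C≤F
  ... | D , a′ , eq =
    h₂ g (spine F f (suc (dim B))) B D a a′ b g∶C
       (trans eq (cong (λ z → just (Hom D a′ z)) (sym b-on-spine)))
       (subst (λ z → ¬ IsSrc Γ z) (spine-top (Hom B a b) g) (g-ns (suc (dim B)) ≤-refl))
       (f-ns (suc (dim B)) C≤F)
    where
    b-ns : SpineNonSource Γ b B
    b-ns k k≤ = subst (λ z → ¬ IsSrc Γ z) (spine-below B a b g k k≤) (g-ns k (≤-trans k≤ (n≤1+n _)))
    b-on-spine : b ≡ spine F f (dim B)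
    b-on-spine = on-spine B b (proj₂ (wf g B a b g∶C)) b-ns F f f∶F f-ns (≤-trans (n≤1+n _) C≤F)

  maximal-unique′ : ∀ C g F f → lookupVar Γ g ≡ just C → lookupVar Γ f ≡ just F →
                    SpineNonSource Γ g C → SpineNonSource Γ f F → ¬ IsTgt Γ g → dim C ≤ dim F → g ≡ f
  maximal-unique′ C g F f g∶C f∶F g-ns f-ns ¬tgt C≤F with m≤n⇒m<n∨m≡n C≤F
  ... | inj₂ e = trans (on-spine C g g∶C g-ns F f f∶F f-ns C≤F) (trans (cong (spine F f) e) (spine-top F f))
  ... | inj₁ C<F with spine-declared-Hom Γ wf F f f∶F (dim C) C<F
  ...   | D , a′ , eq = ⊥-elim (¬tgt (spine F f (suc (dim C)) , D , a′ ,
                          trans eq (cong (λ z → just (Hom D a′ z)) (sym (on-spine C g g∶C g-ns F f f∶F f-ns C≤F)))))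

  maximal-unique : ∀ C g F f → lookupVar Γ g ≡ just C → lookupVar Γ f ≡ just F →
                   SpineNonSource Γ g C → SpineNonSource Γ f F → ¬ IsTgt Γ g → ¬ IsTgt Γ f → g ≡ f
  maximal-unique C g F f g∶C f∶F g-ns f-ns ¬g ¬f with ≤-total (dim C) (dim F)
  ... | inj₁ C≤F = maximal-unique′ C g F f g∶C f∶F g-ns f-ns ¬g C≤F
  ... | inj₂ F≤C = sym (maximal-unique′ F f C g f∶F g∶C f-ns g-ns ¬f F≤C)

data Shape : Ctx → Set where
  point : ∀ z → Shape (∅ ▸ z ∶ ⋆)
  snoc  : ∀ {Γ y B f a} → Γ ⊢ps a ∶ B → y ∉FV Γ → f ∉FV Γ → y ≢ f → Shape (Γ ▸ y ∶ B ▸ f ∶ Hom B a y)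

shape : ∀ {Γ x A} → Γ ⊢ps x ∶ A → Shape Γ
shape (ps-start z)          = point z
shape (ps-ext d y∉ f∉ y≢f) = snoc d y∉ f∉ y≢f
shape (ps-drop d)           = shape d

SameLookups : Ctx → Ctx → Set
SameLookups Γ Δ = ∀ v → lookupVar Γ v ≡ lookupVar Δ v

point≢snoc : ∀ {Γ y B f a} z → ¬ SameLookups (∅ ▸ z ∶ ⋆) (Γ ▸ y ∶ B ▸ f ∶ Hom B a y)
point≢snoc {Γ} {y} {B} {f} z same with lookup-point z f
... | inj₁ (_ , h) = Hom≢⋆ (trans (sym (lookup-here (Γ ▸ y ∶ B) f _)) (trans (sym (same f)) h))
... | inj₂ h       = nothing≢just (trans (sym h) (trans (same f) (lookup-here (Γ ▸ y ∶ B) f _)))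

lookups-determine : ∀ Γ Δ {x A x′ A′} → Γ ⊢ps x ∶ A → Δ ⊢ps x′ ∶ A′ → SameLookups Γ Δ → Γ ≡ Δ
lookups-determine Γ Δ dΓ dΔ same = by-shape (shape dΓ) (shape dΔ)
  where
  by-shape : Shape Γ → Shape Δ → Γ ≡ Δ
  by-shape (point z) (point z′) with lookup-point z′ z
  ... | inj₁ (z≡z′ , _) = cong (λ w → ∅ ▸ w ∶ ⋆) z≡z′
  ... | inj₂ h          = ⊥-elim (nothing≢just (trans (sym h) (trans (sym (same z)) (lookup-here ∅ z ⋆))))
  by-shape (point z) (snoc _ _ _ _) = ⊥-elim (point≢snoc z same)
  by-shape (snoc _ _ _ _) (point z) = ⊥-elim (point≢snoc z (λ v → sym (same v)))
  by-shape (snoc {Γ′} {y} {B} {f} {a} d y∉ f∉ y≢f) (snoc {Δ′} {y′} {B′} {f′} {a′} d′ y′∉ f′∉ y′≢f′) =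
    same-snoc f≡f′
    where
    module SΓ = SnocSources Γ′ a B y f (⊢ps-declared d) (⊢ps-wellFormed d) y∉ f∉ y≢f
    module SΔ = SnocSources Δ′ a′ B′ y′ f′ (⊢ps-declared d′) (⊢ps-wellFormed d′) y′∉ f′∉ y′≢f′
    open Snoc Γ′ a B y f (⊢ps-declared d) y∉ f∉ y≢f using (lookup-f; lookup-old)
    open Snoc Δ′ a′ B′ y′ f′ (⊢ps-declared d′) y′∉ f′∉ y′≢f′
      using () renaming (lookup-f to lookup-f′; lookup-old to lookup-old′)

    invΓ : SpineNonSource Γ f (Hom B a y) × NonSourceByTarget Γ × NonSourcePoint Γ
    invΓ = ⊢ps-invariants (ps-ext d y∉ f∉ y≢f)
    invΔ : SpineNonSource Δ f′ (Hom B′ a′ y′) × NonSourceByTarget Δ × NonSourcePoint Δ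
    invΔ = ⊢ps-invariants (ps-ext d′ y′∉ f′∉ y′≢f′)

    f≡f′ : f ≡ f′
    f≡f′ = Maximal.maximal-unique Γ (⊢ps-wellFormed dΓ) (proj₁ (proj₂ invΓ)) (proj₂ (proj₂ invΓ))
             (Hom B a y) f (Hom B′ a′ y′) f′ lookup-f (trans (same f′) lookup-f′)
             (proj₁ invΓ)
             (λ k k≤ (w , C , b , e) → proj₁ invΔ k k≤ (w , C , b , trans (sym (same w)) e))
             SΓ.¬IsTgt-f
             (λ (w , C , b , e) → SΔ.¬IsTgt-f (w , C , b , trans (sym (same w)) e))

    same-snoc : f ≡ f′ → Γ ≡ Δ
    same-snoc refl with trans (sym lookup-f) (trans (same f) lookup-f′)
    ... | refl = cong (λ Θ → Θ ▸ y ∶ B ▸ f ∶ Hom B a y) (lookups-determine Γ′ Δ′ d d′ same′)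
      where
      same′ : SameLookups Γ′ Δ′
      same′ v with v ≟ f | v ≟ y
      ... | yes refl | _        = trans (lookup-fresh Γ′ v f∉) (sym (lookup-fresh Δ′ v f′∉))
      ... | no _     | yes refl = trans (lookup-fresh Γ′ v y∉) (sym (lookup-fresh Δ′ v y′∉))
      ... | no v≢f   | no v≢y   = trans (sym (lookup-old v v≢y v≢f)) (trans (same v) (lookup-old′ v v≢y v≢f))

SameVG-sym : ∀ {G H} → SameVG G H → SameVG H G
SameVG-sym {G} {H} (same-mem , same-bd) =
  (λ n v → sym (same-mem n v)) ,
  λ n v v∈ → let r = same-bd n v (subst T (sym (same-mem (suc n) v)) v∈) in sym (proj₁ r) , sym (proj₂ r)

-- A declaration is recovered from G^Γ since the source and target of a cell are declared too.
SameVG⇒declared : ∀ Γ Δ → WellFormed Γ → WellFormed Δ → SameVG (G^ Γ) (G^ Δ) →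
                  ∀ C v → lookupVar Γ v ≡ just C → lookupVar Δ v ≡ just C
SameVG⇒declared Γ Δ wfΓ wfΔ (same-mem , same-bd) ⋆ v v∶⋆
  with mem⇒declared Δ 0 v (subst T (same-mem 0 v) (declared⇒mem Γ v ⋆ 0 v∶⋆ refl))
... | ⋆ , v∶D , _ = v∶D
SameVG⇒declared Γ Δ wfΓ wfΔ (same-mem , same-bd) (Hom B a c) v v∶C
  with mem⇒declared Δ (suc (dim B)) v (subst T (same-mem _ v) (declared⇒mem Γ v (Hom B a c) _ v∶C refl))
... | Hom B′ a′ c′ , v∶D , _ = trans v∶D (cong just (sym (cong₃ Hom B≡B′ a≡a′ c≡c′)))
  where
  bd : src (G^ Γ) (dim B) v ≡ src (G^ Δ) (dim B) v × tgt (G^ Γ) (dim B) v ≡ tgt (G^ Δ) (dim B) v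
  bd = same-bd (dim B) v (declared⇒mem Γ v (Hom B a c) _ v∶C refl)
  a≡a′ : a ≡ a′
  a≡a′ = trans (sym (src-declared Γ (dim B) v B a c v∶C)) (trans (proj₁ bd) (src-declared Δ (dim B) v B′ a′ c′ v∶D))
  c≡c′ : c ≡ c′
  c≡c′ = trans (sym (tgt-declared Γ (dim B) v B a c v∶C)) (trans (proj₂ bd) (tgt-declared Δ (dim B) v B′ a′ c′ v∶D))
  B≡B′ : B ≡ B′
  B≡B′ = just-injective (trans (sym (SameVG⇒declared Γ Δ wfΓ wfΔ (same-mem , same-bd) B a (proj₁ (wfΓ v B a c v∶C))))
                              (trans (cong (lookupVar Δ) a≡a′) (proj₁ (wfΔ v B′ a′ c′ v∶D))))
  cong₃ : ∀ (g : Ty → Var → Var → Ty) {B B′ a a′ c c′} → B ≡ B′ → a ≡ a′ → c ≡ c′ → g B a c ≡ g B′ a′ c′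
  cong₃ g refl refl refl = refl

SameVG⇒SameLookups : ∀ Γ Δ → WellFormed Γ → WellFormed Δ → SameVG (G^ Γ) (G^ Δ) → SameLookups Γ Δ
SameVG⇒SameLookups Γ Δ wfΓ wfΔ same v with lookupVar Γ v in eΓ
... | just C = sym (SameVG⇒declared Γ Δ wfΓ wfΔ same C v eΓ)
... | nothing with lookupVar Δ v in eΔ
...   | just C  = ⊥-elim (nothing≢just (trans (sym eΓ) (SameVG⇒declared Δ Γ wfΔ wfΓ (SameVG-sym same) C v eΔ)))
...   | nothing = refl

ps-injective : (Γ Δ : Ctx) → Γ ⊢ps → Δ ⊢ps → SameVG (G^ Γ) (G^ Δ) → Γ ≡ Δ
ps-injective Γ Δ (ps-done dΓ) (ps-done dΔ) same =
  lookups-determine Γ Δ dΓ dΔ (SameVG⇒SameLookups Γ Δ (⊢ps-wellFormed dΓ) (⊢ps-wellFormed dΔ) same)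

mainTheorem4 : ((Γ : Ctx) → Γ ⊢ps → In𝒢 (G^ Γ))
    × ((Γ Δ : Ctx) → Γ ⊢ps → Δ ⊢ps → SameVG (G^ Γ) (G^ Δ) → Γ ≡ Δ)
    × ((G : VGSet) → In𝒢 G → Σ Ctx (λ Γ → Γ ⊢ps × SameVG (G^ Γ) G))
mainTheorem4 = ps⇒In𝒢 , ps-injective , In𝒢⇒ps
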